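{- Let $p$ be an odd prime and let $G \cong \langle a \rangle \rtimes \langle b \rangle$, where $[a,b] = a^{p^{\alpha-\gamma}}$, $o(a) = p^{\alpha}$, $o(b) = p^{\beta}$, $o([a,b]) = p^{\gamma}$, with $\alpha,\beta,\gamma \in \mathbb{N}$, $\alpha \ge 2\gamma$, $\beta \ge \gamma \ge 1$. Then $D'(G) = D(G)$.
   Context: $[x,y]=x^{ -1}y^{ -1}xy$. For a finite group $G$: $D(G)$ is the least positive integer $k$ such that every sequence $g_1\cdots g_k$ of $k$ elements of $G$ (repetitions allowed) has indices $1\le i_1<\cdots<i_m\le k$, $m\ge1$, with $g_{i_1}\cdots g_{i_m}=1$ (product in increasing index order). $D'(G)$ is the least positive integer $k$ such that every sequence $g_1\cdots g_k$ of $k$ elements of $G$ has a nonempty subsequence $g_{i_1},\dots,g_{i_m}$ with $g_{i_{\tau(1)}}\cdots g_{i_{\tau(m)}} = 1$ for some permutation $\tau$ of $\{1,\dots,m\}$. -}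

module Defs where

open import Level using (Level; _⊔_)
open import Algebra.Bundles using (Group)
open import Data.Nat using (ℕ; zero; suc; _<_)
open import Data.List using (List; []; _∷_; foldr; length)
open import Data.List.Relation.Binary.Sublist.Propositional using (_⊆_)
open import Data.List.Relation.Binary.Permutation.Propositional using (_↭_)
open import Data.Product using (Σ; _×_; ∃; ∃-syntax)
open import Relation.Binary.PropositionalEquality using (_≡_; _≢_)
open import Relation.Nullary using (¬_)

IsLeastPos : ∀ {ℓ} → (ℕ → Set ℓ) → ℕ → Set ℓ
IsLeastPos P k = (0 < k) × P k × (∀ j → 0 < j → j < k → ¬ P j)

module GroupDefs {c ℓ : Level} (G : Group c ℓ) where
  open Group G

  pow : Carrier → ℕ → Carrier
  pow x zero    = ε
  pow x (suc n) = x ∙ pow x n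

  comm : Carrier → Carrier → Carrier
  comm x y = ((x ⁻¹ ∙ y ⁻¹) ∙ x) ∙ y

  HasOrder : Carrier → ℕ → Set ℓ
  HasOrder x n = IsLeastPos (λ m → pow x m ≈ ε) n

  prod : List Carrier → Carrier
  prod = foldr _∙_ ε

  DProp : ℕ → Set (c ⊔ ℓ)
  DProp k = ∀ (xs : List Carrier) → length xs ≡ k →
    ∃[ ys ] (ys ⊆ xs × ys ≢ [] × prod ys ≈ ε)

  D′Prop : ℕ → Set (c ⊔ ℓ)
  D′Prop k = ∀ (xs : List Carrier) → length xs ≡ k →
    ∃[ ys ] (ys ⊆ xs × ys ≢ [] × ∃[ zs ] (zs ↭ ys × prod zs ≈ ε))

  IsD : ℕ → Set (c ⊔ ℓ)
  IsD = IsLeastPos DProp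

  IsD′ : ℕ → Set (c ⊔ ℓ)
  IsD′ = IsLeastPos D′Prop

  -- G is the internal semidirect product ⟨a⟩ ⋊ ⟨b⟩ with [a,b] = a^(e)
  -- (⟨a⟩ normal follows from the commutator relation; G = ⟨a⟩⟨b⟩; ⟨a⟩ ∩ ⟨b⟩ = 1)
  IsSemidirectCyclic : Carrier → Carrier → Set (c ⊔ ℓ)
  IsSemidirectCyclic a b =
    (∀ g → ∃[ i ] ∃[ j ] (g ≈ pow a i ∙ pow b j)) ×
    (∀ i j → pow a i ≈ pow b j → pow a i ≈ ε)

module Submission where

-- Write every element as bᵛ aᵘ. Functions on these coordinates, with values in 𝔽ₚ, model the group
-- algebra, and right multiplication by g acts on them by a translation ρ_g. Let δ be the indicator of 1.
-- If no nonempty subsequence of g₁ ⋯ g_K has product 1 (in order), then (∏ (ρ_gᵢ - 1)) δ takes the value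
-- (-1)ᴷ at 1. On the other hand, each ρ_g - 1 lowers the degree of a function (measured by iterated
-- finite differences) by one: for ρ_a this is a difference, for ρ_b, which rescales by r = 1 + pᵉ, it
-- follows from the Frobenius identity Δ^(pᵉ) = Δ_(pᵉ) in characteristic p. Being periodic with periods
-- pᵅ and pᵝ, δ has degree < pᵅ + pᵝ - 1, so for K = pᵅ + pᵝ - 1 the value is 0. Hence
-- D(G) ≤ pᵅ + pᵝ - 1. Conversely, in a^(pᵅ-1) b^(pᵝ-1) no nonempty subsequence has product 1 in any
-- order, since the b-exponent modulo pᵝ counts the b's; so D'(G) ≥ pᵅ + pᵝ - 1, and D'(G) ≤ D(G).

open import Defs
open import Level using (Level; _⊔_; 0ℓ)
open import Algebra.Bundles using (Group)
import Algebra.Properties.Group as GroupProperties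
open import Data.Nat.Base
  using (ℕ; zero; suc; pred; _+_; _*_; _∸_; _^_; _≤_; _<_; z≤n; s≤s; NonZero; >-nonZero; >-nonZero⁻¹; nonTrivial⇒n>1)
open import Data.Nat.Properties
open import Data.Nat.DivMod
  using (_%_; _/_; %-distribˡ-+; %-distribˡ-*; m*n%n≡0; m<n⇒m%n≡m; m≡m%n+[m/n]*n; m%n<n; [m+kn]%n≡m%n; [m+n]%n≡m%n; m%n%n≡m%n)
open import Data.Nat.Divisibility using (_∣_; divides; ∣⇒≤; ∣1⇒≡1; m%n≡0⇒n∣m)
open import Data.Nat.Primality using (Prime; euclidsLemma; prime⇒nonZero; prime⇒nonTrivial)
open import Data.Nat.Combinatorics using (_C_; nCn≡1; nC1≡n; nCk+nC[k+1]≡[n+1]C[k+1])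
open import Data.Nat.Combinatorics.Specification using (k>n⇒nCk≡0)
open import Data.Nat.ListAction using (sum)
open import Data.Nat.ListAction.Properties using (sum-↭; sum-++)
open import Data.Nat.Tactic.RingSolver using (solve-∀)
open import Data.Product using (_×_; _,_; proj₁; proj₂; ∃-syntax)
open import Data.Sum using (_⊎_; inj₁; inj₂)
open import Data.Empty using (⊥-elim)
open import Data.List using (List; []; _∷_; length; map; replicate; _++_; take)
open import Data.List.Properties
  using (length-map; map-++; map-replicate; ++-identityʳ; length-replicate; length-++; length-take)
open import Data.List.Relation.Unary.All using (All; []; _∷_)
open import Data.List.Relation.Unary.All.Properties using (replicate⁺)
open import Data.List.Relation.Binary.Sublist.Propositional using (_⊆_; []; _∷_; _∷ʳ_; minimum; ⊆-trans)
open import Data.List.Relation.Binary.Sublist.Propositional.Properties using (take-⊆)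
open import Data.List.Relation.Binary.Permutation.Propositional using (_↭_; ↭-sym; ↭-refl)
open import Data.List.Relation.Binary.Permutation.Propositional.Properties using (map⁺; ↭-length; All-resp-↭)
open import Function.Base using (_∘_; const)
open import Relation.Binary.Bundles using (Setoid)
open import Relation.Binary.Structures using (IsEquivalence)
import Relation.Binary.PropositionalEquality as ≡
open ≡ using (_≡_; _≢_)
open import Relation.Nullary using (¬_; yes; no)
import Relation.Binary.Reasoning.Setoid as SetoidReasoning

infixr 9 _^[_]_

_^[_]_ : ∀ {a} {A : Set a} → (A → A) → ℕ → A → A
f ^[ zero ] x = x
f ^[ suc n ] x = f (f ^[ n ] x)

^[]-+ : ∀ {a} {A : Set a} (f : A → A) → ∀ m n x → f ^[ m + n ] x ≡ f ^[ m ] (f ^[ n ] x)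
^[]-+ f zero    n x = ≡.refl
^[]-+ f (suc m) n x = ≡.cong f (^[]-+ f m n x)

^[]-* : ∀ {a} {A : Set a} (f : A → A) → ∀ m n x → f ^[ m * n ] x ≡ (f ^[ n ]_) ^[ m ] x
^[]-* f zero    n x = ≡.refl
^[]-* f (suc m) n x = ≡.trans (^[]-+ f n (m * n) x) (≡.cong (f ^[ n ]_) (^[]-* f m n x))

^[]-suc : ∀ {a} {A : Set a} (f : A → A) → ∀ n x → f ^[ suc n ] x ≡ f ^[ n ] (f x)
^[]-suc f zero    x = ≡.refl
^[]-suc f (suc n) x = ≡.cong f (^[]-suc f n x)

module _ {a ℓ} (S : Setoid a ℓ) where
  open Setoid S

  ^[]-cong : {F G : Carrier → Carrier} → (∀ {x y} → x ≈ y → F x ≈ G y) →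
             ∀ k {x y} → x ≈ y → F ^[ k ] x ≈ G ^[ k ] y
  ^[]-cong F≈G zero    x≈y = x≈y
  ^[]-cong F≈G (suc k) x≈y = F≈G (^[]-cong F≈G k x≈y)

∑< : ℕ → (ℕ → ℕ) → ℕ
∑< zero    f = 0
∑< (suc n) f = f 0 + ∑< n (f ∘ suc)

infixl 10 ∑<
syntax ∑< n (λ t → e) = ∑[ t < n ] e

∑-cong : ∀ n {f g : ℕ → ℕ} → (∀ t → f t ≡ g t) → ∑< n f ≡ ∑< n g
∑-cong zero    e = ≡.refl
∑-cong (suc n) e = ≡.cong₂ _+_ (e 0) (∑-cong n (e ∘ suc))

∑-distrib-+ : ∀ n (f g : ℕ → ℕ) → ∑[ t < n ] (f t + g t) ≡ ∑< n f + ∑< n g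
∑-distrib-+ zero    f g = ≡.refl
∑-distrib-+ (suc n) f g =
  ≡.trans (≡.cong (f 0 + g 0 +_) (∑-distrib-+ n (f ∘ suc) (g ∘ suc))) (interchange (f 0) (g 0) _ _)
  where
    interchange : ∀ a b c d → a + b + (c + d) ≡ a + c + (b + d)
    interchange = solve-∀

∑-*ˡ : ∀ n k (f : ℕ → ℕ) → ∑[ t < n ] (k * f t) ≡ k * ∑< n f
∑-*ˡ zero    k f = ≡.sym (*-zeroʳ k)
∑-*ˡ (suc n) k f = ≡.trans (≡.cong (k * f 0 +_) (∑-*ˡ n k (f ∘ suc))) (≡.sym (*-distribˡ-+ k (f 0) _))

∑-last : ∀ n (f : ℕ → ℕ) → ∑< (suc n) f ≡ ∑< n f + f n
∑-last zero    f = +-comm (f 0) 0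
∑-last (suc n) f = ≡.trans (≡.cong (f 0 +_) (∑-last n (f ∘ suc))) (≡.sym (+-assoc (f 0) _ _))

[1+k]*[1+n]C[1+k]≡[1+n]*nCk : ∀ n k → suc k * (suc n C suc k) ≡ suc n * (n C k)
[1+k]*[1+n]C[1+k]≡[1+n]*nCk zero    zero    = ≡.refl
[1+k]*[1+n]C[1+k]≡[1+n]*nCk zero    (suc k) = *-zeroʳ (2 + k)
[1+k]*[1+n]C[1+k]≡[1+n]*nCk (suc n) zero    =
  ≡.trans (*-identityˡ _) (≡.trans (nC1≡n (2 + n)) (≡.sym (*-identityʳ (2 + n))))
[1+k]*[1+n]C[1+k]≡[1+n]*nCk (suc n) (suc k) = begin
  (2 + k) * ((2 + n) C (2 + k))
    ≡⟨ ≡.cong ((2 + k) *_) (nCk+nC[k+1]≡[n+1]C[k+1] (suc n) (suc k)) ⟨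
  (2 + k) * (A + (1 + n) C (2 + k))
    ≡⟨ *-distribˡ-+ (2 + k) A _ ⟩
  A + (1 + k) * A + (2 + k) * ((1 + n) C (2 + k))
    ≡⟨ ≡.cong₂ (λ x y → A + x + y) ([1+k]*[1+n]C[1+k]≡[1+n]*nCk n k) ([1+k]*[1+n]C[1+k]≡[1+n]*nCk n (suc k)) ⟩
  A + (1 + n) * (n C k) + (1 + n) * (n C (1 + k))
    ≡⟨ +-assoc A _ _ ⟩
  A + ((1 + n) * (n C k) + (1 + n) * (n C (1 + k)))
    ≡⟨ ≡.cong (A +_) (*-distribˡ-+ (1 + n) (n C k) _) ⟨
  A + (1 + n) * (n C k + n C (1 + k))
    ≡⟨ ≡.cong (λ x → A + (1 + n) * x) (nCk+nC[k+1]≡[n+1]C[k+1] n k) ⟩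
  (2 + n) * A ∎
  where
    open ≡.≡-Reasoning
    A = (1 + n) C (1 + k)

[x+pred[n]*y]%n≡0⇒x%n≡y%n : ∀ x y n .{{_ : NonZero n}} → (x + pred n * y) % n ≡ 0 → x % n ≡ y % n
[x+pred[n]*y]%n≡0⇒x%n≡y%n x y n eq = begin
  x % n                                  ≡⟨ [m+kn]%n≡m%n x y n ⟨
  (x + y * n) % n                        ≡⟨ ≡.cong (λ k → (x + y * k) % n) (suc-pred n) ⟨
  (x + y * suc (pred n)) % n             ≡⟨ ≡.cong (_% n) (regroup x y (pred n)) ⟩
  (x + pred n * y + y) % n               ≡⟨ %-distribˡ-+ (x + pred n * y) y n ⟩
  ((x + pred n * y) % n + y % n) % n     ≡⟨ ≡.cong (λ k → (k + y % n) % n) eq ⟩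
  y % n % n                              ≡⟨ m%n%n≡m%n y n ⟩
  y % n                                  ∎
  where
    open ≡.≡-Reasoning
    regroup : ∀ x y k → x + y * suc k ≡ x + k * y + y
    regroup = solve-∀

x+pred[k]*x≡x*k : ∀ x k .{{_ : NonZero k}} → x + pred k * x ≡ x * k
x+pred[k]*x≡x*k x k = ≡.trans (≡.cong (_* x) (suc-pred k)) (*-comm k x)

module _ {a} {A : Set a} where

  ⊆-replicate : ∀ l {x : A} {ys} → ys ⊆ replicate l x → ∃[ t ] (t ≤ l × ys ≡ replicate t x)
  ⊆-replicate zero    {ys = []}     []            = 0 , z≤n , ≡.refl
  ⊆-replicate (suc l) {ys = ys}     (_ ∷ʳ ys⊆)      =
    let (t , t≤l , ys≡) = ⊆-replicate l ys⊆ in t , m≤n⇒m≤1+n t≤l , ys≡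
  ⊆-replicate (suc l) {ys = y ∷ ys} (≡.refl ∷ ys⊆) =
    let (t , t≤l , ys≡) = ⊆-replicate l ys⊆ in suc t , s≤s t≤l , ≡.cong (y ∷_) ys≡

  ⊆-replicate-++ : ∀ k {x : A} {zs ys} → ys ⊆ replicate k x ++ zs →
                   ∃[ s ] ∃[ ys′ ] (s ≤ k × ys ≡ replicate s x ++ ys′ × ys′ ⊆ zs)
  ⊆-replicate-++ zero                  ys⊆          = 0 , _ , z≤n , ≡.refl , ys⊆
  ⊆-replicate-++ (suc k) {ys = ys}     (_ ∷ʳ ys⊆)   =
    let (s , ys′ , s≤k , ys≡ , ys′⊆) = ⊆-replicate-++ k ys⊆ in s , ys′ , m≤n⇒m≤1+n s≤k , ys≡ , ys′⊆
  ⊆-replicate-++ (suc k) {ys = y ∷ ys} (≡.refl ∷ ys⊆) =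
    let (s , ys′ , s≤k , ys≡ , ys′⊆) = ⊆-replicate-++ k ys⊆ in suc s , ys′ , s≤s s≤k , ≡.cong (y ∷_) ys≡ , ys′⊆

sum-replicate : ∀ s k → sum (replicate s k) ≡ s * k
sum-replicate zero    k = ≡.refl
sum-replicate (suc s) k = ≡.cong (k +_) (sum-replicate s k)

module Modulo (d : ℕ) .{{_ : NonZero d}} where

  open ≡ using (refl; sym; trans; cong; cong₂; module ≡-Reasoning)

  infix 4 _≈_ _≋_ _≋₂_

  record _≈_ (x y : ℕ) : Set where
    constructor mk≈
    field %-≡ : x % d ≡ y % d
  open _≈_ public

  ≈-isEquivalence : IsEquivalence _≈_
  ≈-isEquivalence = record
    { refl  = mk≈ refl
    ; sym   = λ (mk≈ e) → mk≈ (sym e)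
    ; trans = λ (mk≈ e) (mk≈ e′) → mk≈ (trans e e′)
    }

  open IsEquivalence ≈-isEquivalence public
    using () renaming (refl to ≈-refl; sym to ≈-sym; trans to ≈-trans; reflexive to ≡⇒≈)

  ≈-setoid : Setoid 0ℓ 0ℓ
  ≈-setoid = record { isEquivalence = ≈-isEquivalence }

  +-cong : ∀ {x x′ y y′} → x ≈ x′ → y ≈ y′ → x + y ≈ x′ + y′
  +-cong {x} {x′} {y} {y′} (mk≈ e₁) (mk≈ e₂) = mk≈ (begin
    (x + y) % d            ≡⟨ %-distribˡ-+ x y d ⟩
    (x % d + y % d) % d    ≡⟨ cong₂ (λ s t → (s + t) % d) e₁ e₂ ⟩
    (x′ % d + y′ % d) % d  ≡⟨ %-distribˡ-+ x′ y′ d ⟨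
    (x′ + y′) % d          ∎)
    where open ≡-Reasoning

  *-cong : ∀ {x x′ y y′} → x ≈ x′ → y ≈ y′ → x * y ≈ x′ * y′
  *-cong {x} {x′} {y} {y′} (mk≈ e₁) (mk≈ e₂) = mk≈ (begin
    (x * y) % d              ≡⟨ %-distribˡ-* x y d ⟩
    (x % d * (y % d)) % d    ≡⟨ cong₂ (λ s t → (s * t) % d) e₁ e₂ ⟩
    (x′ % d * (y′ % d)) % d  ≡⟨ %-distribˡ-* x′ y′ d ⟨
    (x′ * y′) % d            ∎)
    where open ≡-Reasoning

  *-congˡ : ∀ k {y y′} → y ≈ y′ → k * y ≈ k * y′
  *-congˡ k = *-cong {k} ≈-refl

  *-congʳ : ∀ k {x x′} → x ≈ x′ → x * k ≈ x′ * k
  *-congʳ k e = *-cong e ≈-refl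

  d*m≈0 : ∀ m → d * m ≈ 0
  d*m≈0 m = mk≈ (trans (cong (_% d) (*-comm d m))
                 (trans (m*n%n≡0 m d) (sym (m<n⇒m%n≡m (>-nonZero⁻¹ d)))))

  x+d*y≈x : ∀ x y → x + d * y ≈ x
  x+d*y≈x x y = ≈-trans (+-cong ≈-refl (d*m≈0 y)) (≡⇒≈ (+-identityʳ x))

  ∑≈0 : ∀ n f → (∀ t → t < n → f t ≈ 0) → ∑< n f ≈ 0
  ∑≈0 zero    f _     = ≈-refl
  ∑≈0 (suc n) f f≈0 = +-cong (f≈0 0 (s≤s z≤n)) (∑≈0 n (f ∘ suc) λ t t<n → f≈0 (suc t) (s≤s t<n))

  ≈0⇒∣ : ∀ {x} → x ≈ 0 → d ∣ x
  ≈0⇒∣ {x} (mk≈ x%d≡0%d) = m%n≡0⇒n∣m x d (trans x%d≡0%d (m<n⇒m%n≡m (>-nonZero⁻¹ d)))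

  ∣⇒≈0 : ∀ {x} → d ∣ x → x ≈ 0
  ∣⇒≈0 (divides k refl) = ≈-trans (≡⇒≈ (*-comm k d)) (d*m≈0 k)

  record _≋_ (f g : ℕ → ℕ) : Set where
    constructor mk≋
    field at : ∀ u → f u ≈ g u
  open _≋_ public

  ≋-setoid : Setoid 0ℓ 0ℓ
  ≋-setoid = record
    { Carrier       = ℕ → ℕ
    ; _≈_           = _≋_
    ; isEquivalence = record
      { refl  = mk≋ λ _ → ≈-refl
      ; sym   = λ e → mk≋ λ u → ≈-sym (at e u)
      ; trans = λ e e′ → mk≋ λ u → ≈-trans (at e u) (at e′ u)
      }
    }

  open Setoid ≋-setoid public
    using () renaming (refl to ≋-refl; trans to ≋-trans; reflexive to ≡⇒≋)

  record _≋₂_ (f g : ℕ → ℕ → ℕ) : Set where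
    constructor mk≋₂
    field at₂ : ∀ v u → f v u ≈ g v u
  open _≋₂_ public

  ≋₂-setoid : Setoid 0ℓ 0ℓ
  ≋₂-setoid = record
    { Carrier       = ℕ → ℕ → ℕ
    ; _≈_           = _≋₂_
    ; isEquivalence = record
      { refl  = mk≋₂ λ _ _ → ≈-refl
      ; sym   = λ e → mk≋₂ λ v u → ≈-sym (at₂ e v u)
      ; trans = λ e e′ → mk≋₂ λ v u → ≈-trans (at₂ e v u) (at₂ e′ v u)
      }
    }

  open Setoid ≋₂-setoid public
    using () renaming (refl to ≋₂-refl; sym to ≋₂-sym; trans to ≋₂-trans)

module FiniteDifferences (p : ℕ) (p-prime : Prime p) where

  open ≡ using (refl; sym; trans; cong; cong₂; subst; module ≡-Reasoning)

  instance
    p≢0 : NonZero p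
    p≢0 = prime⇒nonZero p-prime

  open Modulo p public

  Seq : Set
  Seq = ℕ → ℕ

  -- Residues modulo p are represented by natural numbers, so p-1 plays the role of -1.
  p-1 : ℕ
  p-1 = pred p

  x+[p-1]x≈0 : ∀ x → x + p-1 * x ≈ 0
  x+[p-1]x≈0 x = ≈-trans (≡⇒≈ (cong (_* x) (suc-pred p))) (d*m≈0 x)

  y+[x+[p-1]x]≈y : ∀ y x → y + (x + p-1 * x) ≈ y
  y+[x+[p-1]x]≈y y x = ≈-trans (+-cong {y} ≈-refl (x+[p-1]x≈0 x)) (≡⇒≈ (+-identityʳ y))

  x+[p-1]y≈0⇒x≈y : ∀ {x y} → x + p-1 * y ≈ 0 → x ≈ y
  x+[p-1]y≈0⇒x≈y {x} {y} x-y≈0 = begin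
    x                      ≈⟨ y+[x+[p-1]x]≈y x y ⟨
    x + (y + p-1 * y)      ≡⟨ regroup x y p-1 ⟩
    x + p-1 * y + y        ≈⟨ +-cong x-y≈0 ≈-refl ⟩
    y                      ∎
    where
      open SetoidReasoning ≈-setoid
      regroup : ∀ x y w → x + (y + w * y) ≡ x + w * y + y
      regroup = solve-∀

  1<p : 1 < p
  1<p = nonTrivial⇒n>1 p {{prime⇒nonTrivial p-prime}}

  1≉0 : ¬ 1 ≈ 0
  1≉0 1≈0 = <⇒≢ 1<p (sym (∣1⇒≡1 (≈0⇒∣ 1≈0)))

  [p-1]^k≉0 : ∀ k → ¬ p-1 ^ k ≈ 0
  [p-1]^k≉0 zero    = 1≉0
  [p-1]^k≉0 (suc k) [p-1]^[1+k]≈0 with euclidsLemma p-1 (p-1 ^ k) p-prime (≈0⇒∣ [p-1]^[1+k]≈0)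
  ... | inj₂ p∣[p-1]^k = [p-1]^k≉0 k (∣⇒≈0 p∣[p-1]^k)
  ... | inj₁ p∣p-1     = n≮n p (m≤pred[n]⇒suc[m]≤n (∣⇒≤ {{>-nonZero (suc[m]≤n⇒m≤pred[n] 1<p)}} p∣p-1))

  Δ[_] : ℕ → Seq → Seq
  Δ[ c ] h u = h (u + c) + p-1 * h u

  Δ : Seq → Seq
  Δ = Δ[ 1 ]

  shift : Seq → Seq
  shift h u = h (suc u)

  infixl 6 _⊕_
  _⊕_ : Seq → Seq → Seq
  (h ⊕ h′) u = h u + h′ u

  Δ[]-cong : ∀ c {h h′} → h ≋ h′ → Δ[ c ] h ≋ Δ[ c ] h′
  Δ[]-cong c e = mk≋ λ u → +-cong (at e (u + c)) (*-congˡ p-1 (at e u))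

  Δ[]^-cong : ∀ c k {h h′} → h ≋ h′ → Δ[ c ] ^[ k ] h ≋ Δ[ c ] ^[ k ] h′
  Δ[]^-cong c = ^[]-cong ≋-setoid (Δ[]-cong c)

  Δ[]-⊕ : ∀ c h h′ → Δ[ c ] (h ⊕ h′) ≋ Δ[ c ] h ⊕ Δ[ c ] h′
  Δ[]-⊕ c h h′ = mk≋ λ u → ≡⇒≈ (interchange (h (u + c)) (h′ (u + c)) p-1 (h u) (h′ u))
    where
      interchange : ∀ a b w x y → a + b + w * (x + y) ≡ a + w * x + (b + w * y)
      interchange = solve-∀

  Δ[]^-⊕ : ∀ c k h h′ → Δ[ c ] ^[ k ] (h ⊕ h′) ≋ Δ[ c ] ^[ k ] h ⊕ Δ[ c ] ^[ k ] h′
  Δ[]^-⊕ c zero    h h′ = mk≋ λ _ → ≈-refl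
  Δ[]^-⊕ c (suc k) h h′ =
    ≋-trans (Δ[]-cong c (Δ[]^-⊕ c k h h′)) (Δ[]-⊕ c (Δ[ c ] ^[ k ] h) (Δ[ c ] ^[ k ] h′))

  Δ[]^-zero : ∀ c k → Δ[ c ] ^[ k ] const 0 ≋ const 0
  Δ[]^-zero c zero    = mk≋ λ _ → ≈-refl
  Δ[]^-zero c (suc k) = mk≋ λ u →
    ≈-trans (at (Δ[]-cong c (Δ[]^-zero c k)) u) (≡⇒≈ (*-zeroʳ p-1))

  signedBinomial : ℕ → ℕ → ℕ
  signedBinomial zero    zero    = 1
  signedBinomial zero    (suc t) = 0
  signedBinomial (suc k) zero    = p-1 * signedBinomial k zero
  signedBinomial (suc k) (suc t) = signedBinomial k t + p-1 * signedBinomial k (suc t)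

  signedBinomial-vanishes : ∀ k t → k < t → signedBinomial k t ≡ 0
  signedBinomial-vanishes zero    (suc t) _         = refl
  signedBinomial-vanishes (suc k) (suc t) (s≤s k<t) =
    trans (cong₂ (λ x y → x + p-1 * y) (signedBinomial-vanishes k t k<t) (signedBinomial-vanishes k (suc t) (m<n⇒m<1+n k<t)))
          (*-zeroʳ p-1)

  signedBinomial≡C : ∀ k t → signedBinomial k t ≡ (k C t) * p-1 ^ (k ∸ t)
  signedBinomial≡C zero    zero    = refl
  signedBinomial≡C zero    (suc t) = refl
  signedBinomial≡C (suc k) zero    = begin
    p-1 * signedBinomial k zero  ≡⟨ cong (p-1 *_) (signedBinomial≡C k zero) ⟩
    p-1 * (1 * p-1 ^ k)          ≡⟨ cong (p-1 *_) (*-identityˡ (p-1 ^ k)) ⟩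
    p-1 ^ suc k                  ≡⟨ *-identityˡ (p-1 ^ suc k) ⟨
    1 * p-1 ^ suc k              ∎
    where open ≡-Reasoning
  signedBinomial≡C (suc k) (suc t) = begin
    signedBinomial k t + p-1 * signedBinomial k (suc t)
      ≡⟨ cong₂ (λ x y → x + p-1 * y) (signedBinomial≡C k t) (signedBinomial≡C k (suc t)) ⟩
    (k C t) * p-1 ^ (k ∸ t) + p-1 * ((k C suc t) * p-1 ^ (k ∸ suc t))
      ≡⟨ cong ((k C t) * p-1 ^ (k ∸ t) +_) last-term ⟩
    (k C t) * p-1 ^ (k ∸ t) + (k C suc t) * p-1 ^ (k ∸ t)
      ≡⟨ *-distribʳ-+ (p-1 ^ (k ∸ t)) (k C t) (k C suc t) ⟨
    (k C t + k C suc t) * p-1 ^ (k ∸ t)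
      ≡⟨ cong (_* p-1 ^ (k ∸ t)) (nCk+nC[k+1]≡[n+1]C[k+1] k t) ⟩
    (suc k C suc t) * p-1 ^ (k ∸ t) ∎
    where
      open ≡-Reasoning
      last-term : p-1 * ((k C suc t) * p-1 ^ (k ∸ suc t)) ≡ (k C suc t) * p-1 ^ (k ∸ t)
      last-term with t <? k
      ... | yes t<k = trans (x*[y*z]≡y*[x*z] p-1 (k C suc t) _)
                            (cong (λ n → (k C suc t) * p-1 ^ n) (sym (+-∸-assoc 1 t<k)))
        where
          x*[y*z]≡y*[x*z] : ∀ x y z → x * (y * z) ≡ y * (x * z)
          x*[y*z]≡y*[x*z] = solve-∀
      ... | no t≮k  = trans (cong (λ x → p-1 * (x * p-1 ^ (k ∸ suc t))) C≡0)
                            (trans (*-zeroʳ p-1) (cong (_* p-1 ^ (k ∸ t)) (sym C≡0)))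
        where
          C≡0 : k C suc t ≡ 0
          C≡0 = k>n⇒nCk≡0 (s≤s (≮⇒≥ t≮k))

  Δ[]^-expansion : ∀ c k h u → (Δ[ c ] ^[ k ] h) u ≡ ∑[ t < suc k ] (signedBinomial k t * h (u + c * t))
  Δ[]^-expansion c zero    h u =
    sym (trans (+-identityʳ _) (trans (+-identityʳ _) (cong h (trans (cong (u +_) (*-zeroʳ c)) (+-identityʳ u)))))
  Δ[]^-expansion c (suc k) h u = begin
    (Δ[ c ] ^[ k ] h) (u + c) + p-1 * (Δ[ c ] ^[ k ] h) u
      ≡⟨ cong₂ (λ x y → x + p-1 * y) (Δ[]^-expansion c k h (u + c)) (Δ[]^-expansion c k h u) ⟩
    ∑[ t < suc k ] (B t * h (u + c + c * t)) + p-1 * (B 0 * H 0 + B′)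
      ≡⟨ cong (_+ p-1 * (B 0 * H 0 + B′)) (∑-cong (suc k) λ t → cong (λ z → B t * h z) (reindex t)) ⟩
    A + p-1 * (B 0 * H 0 + B′)
      ≡⟨ rearrange A (B 0) (H 0) B′ p-1 ⟩
    p-1 * B 0 * H 0 + (A + p-1 * (B′ + 0))
      ≡⟨ cong (λ z → p-1 * B 0 * H 0 + (A + p-1 * (B′ + z * H (suc k)))) (signedBinomial-vanishes k (suc k) (n<1+n k)) ⟨
    p-1 * B 0 * H 0 + (A + p-1 * (B′ + B (suc k) * H (suc k)))
      ≡⟨ cong (λ z → p-1 * B 0 * H 0 + (A + p-1 * z)) (∑-last k (λ t → B (suc t) * H (suc t))) ⟨
    p-1 * B 0 * H 0 + (A + p-1 * ∑[ t < suc k ] (B (suc t) * H (suc t)))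
      ≡⟨ cong (λ z → p-1 * B 0 * H 0 + (A + z)) (∑-*ˡ (suc k) p-1 (λ t → B (suc t) * H (suc t))) ⟨
    p-1 * B 0 * H 0 + (A + ∑[ t < suc k ] (p-1 * (B (suc t) * H (suc t))))
      ≡⟨ cong (p-1 * B 0 * H 0 +_) (∑-distrib-+ (suc k) (λ t → B t * H (suc t)) (λ t → p-1 * (B (suc t) * H (suc t)))) ⟨
    p-1 * B 0 * H 0 + ∑[ t < suc k ] (B t * H (suc t) + p-1 * (B (suc t) * H (suc t)))
      ≡⟨ cong (p-1 * B 0 * H 0 +_) (∑-cong (suc k) λ t → collect (B t) (B (suc t)) p-1 (H (suc t))) ⟩
    p-1 * B 0 * H 0 + ∑[ t < suc k ] ((B t + p-1 * B (suc t)) * H (suc t)) ∎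
    where
      open ≡-Reasoning
      B : ℕ → ℕ
      B = signedBinomial k
      H : ℕ → ℕ
      H t = h (u + c * t)
      A  = ∑[ t < suc k ] (B t * H (suc t))
      B′ = ∑[ t < k ] (B (suc t) * H (suc t))
      reindex : ∀ t → u + c + c * t ≡ u + c * suc t
      reindex t = trans (+-assoc u c (c * t)) (cong (u +_) (sym (*-suc c t)))
      rearrange : ∀ a b₀ x b w → a + w * (b₀ * x + b) ≡ w * b₀ * x + (a + w * (b + 0))
      rearrange = solve-∀
      collect : ∀ x y w z → x * z + w * (y * z) ≡ (x + w * y) * z
      collect = solve-∀

  p∣pC[1+t] : ∀ t → suc t < p → p ∣ p C suc t
  p∣pC[1+t] t 1+t<p with euclidsLemma (suc t) (p C suc t) p-prime (divides (pred p C t) pascal)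
    where
      pascal : suc t * (p C suc t) ≡ (pred p C t) * p
      pascal = subst (λ n → suc t * (n C suc t) ≡ (pred n C t) * n) (suc-pred p)
                     (trans ([1+k]*[1+n]C[1+k]≡[1+n]*nCk (pred p) t) (*-comm (suc (pred p)) _))
  ... | inj₁ p∣1+t = ⊥-elim (<⇒≱ 1+t<p (∣⇒≤ p∣1+t))
  ... | inj₂ p∣C   = p∣C

  signedBinomial-interior≈0 : ∀ t → suc t < p → signedBinomial p (suc t) ≈ 0
  signedBinomial-interior≈0 t 1+t<p = ≈-trans (≡⇒≈ (signedBinomial≡C p (suc t)))
                                     (*-congʳ (p-1 ^ (p ∸ suc t)) (∣⇒≈0 (p∣pC[1+t] t 1+t<p)))

  Δ[]^[1+n]≈ : ∀ n → (∀ t → t < n → signedBinomial (suc n) (suc t) ≈ 0) →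
               ∀ c h u → (Δ[ c ] ^[ suc n ] h) u ≈ h (u + c * suc n) + p-1 ^ suc n * h u
  Δ[]^[1+n]≈ n interior c h u = begin
    (Δ[ c ] ^[ suc n ] h) u                         ≡⟨ Δ[]^-expansion c (suc n) h u ⟩
    G 0 + ∑[ t < suc n ] G (suc t)                  ≡⟨ cong (G 0 +_) (∑-last n (G ∘ suc)) ⟩
    G 0 + (∑[ t < n ] G (suc t) + G (suc n))        ≈⟨ +-cong {G 0} ≈-refl (+-cong inner≈0 ≈-refl) ⟩
    G 0 + (0 + G (suc n))                           ≡⟨ cong₂ _+_ G0≡ Gtop≡ ⟩
    p-1 ^ suc n * h u + h (u + c * suc n)           ≡⟨ +-comm (p-1 ^ suc n * h u) _ ⟩
    h (u + c * suc n) + p-1 ^ suc n * h u           ∎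
    where
      open SetoidReasoning ≈-setoid
      G : ℕ → ℕ
      G t = signedBinomial (suc n) t * h (u + c * t)
      inner≈0 : ∑[ t < n ] G (suc t) ≈ 0
      inner≈0 = ∑≈0 n (G ∘ suc) λ t t<n → *-congʳ (h (u + c * suc t)) (interior t t<n)
      G0≡ : G 0 ≡ p-1 ^ suc n * h u
      G0≡ = cong₂ _*_ (trans (signedBinomial≡C (suc n) 0) (*-identityˡ _))
                      (cong h (trans (cong (u +_) (*-zeroʳ c)) (+-identityʳ u)))
      Gtop≡ : G (suc n) ≡ h (u + c * suc n)
      Gtop≡ = trans (cong (_* h (u + c * suc n))
                      (trans (signedBinomial≡C (suc n) (suc n)) (cong₂ _*_ (nCn≡1 (suc n)) (cong (p-1 ^_) (n∸n≡0 n)))))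
                    (*-identityˡ _)

  Δ[]^p≈ : ∀ c h u → (Δ[ c ] ^[ p ] h) u ≈ h (u + c * p) + p-1 ^ p * h u
  Δ[]^p≈ = subst (λ n → ∀ c h u → (Δ[ c ] ^[ n ] h) u ≈ h (u + c * n) + p-1 ^ n * h u) (suc-pred p)
                 (Δ[]^[1+n]≈ (pred p) interior)
    where
      interior : ∀ t → t < pred p → signedBinomial (suc (pred p)) (suc t) ≈ 0
      interior t t<p-1 = subst (λ n → signedBinomial n (suc t) ≈ 0) (sym (suc-pred p))
                               (signedBinomial-interior≈0 t (m≤pred[n]⇒suc[m]≤n t<p-1))

  -- (-1)ᵖ ≡ -1 is read off from the expansion of Δᵖ on the constant sequence 1, which Δ kills.
  [p-1]^p≈p-1 : p-1 ^ p ≈ p-1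
  [p-1]^p≈p-1 = begin
    p-1 ^ p                    ≈⟨ x+d*y≈x (p-1 ^ p) 1 ⟨
    p-1 ^ p + p * 1            ≡⟨ cong (λ n → p-1 ^ p + n * 1) (suc-pred p) ⟨
    p-1 ^ p + suc p-1 * 1      ≡⟨ rearrange (p-1 ^ p) p-1 ⟩
    (1 + p-1 ^ p * 1) + p-1    ≈⟨ +-cong (≈-trans (≈-sym (Δ[]^p≈ 1 (const 1) 0)) Δᵖ1≈0) ≈-refl ⟩
    0 + p-1                    ∎
    where
      open SetoidReasoning ≈-setoid
      rearrange : ∀ a w → a + suc w * 1 ≡ (1 + a * 1) + w
      rearrange = solve-∀
      Δᵖ1≈0 : (Δ ^[ p ] const 1) 0 ≈ 0
      Δᵖ1≈0 = begin
        (Δ ^[ p ] const 1) 0           ≡⟨ cong (λ n → (Δ ^[ n ] const 1) 0) (suc-pred p) ⟨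
        (Δ ^[ suc (pred p) ] const 1) 0 ≡⟨ cong (λ f → f 0) (^[]-suc Δ (pred p) (const 1)) ⟩
        (Δ ^[ pred p ] Δ (const 1)) 0  ≈⟨ at (Δ[]^-cong 1 (pred p) (mk≋ λ _ → x+[p-1]x≈0 1)) 0 ⟩
        (Δ ^[ pred p ] const 0) 0      ≈⟨ at (Δ[]^-zero 1 (pred p)) 0 ⟩
        0                              ∎

  frobenius : ∀ c h → Δ[ c ] ^[ p ] h ≋ Δ[ c * p ] h
  frobenius c h = mk≋ λ u →
    ≈-trans (Δ[]^p≈ c h u) (+-cong {h (u + c * p)} ≈-refl (*-congʳ (h u) [p-1]^p≈p-1))

  Δ^[p^e]≋Δ[p^e] : ∀ e h → Δ ^[ p ^ e ] h ≋ Δ[ p ^ e ] h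
  Δ^[p^e]≋Δ[p^e] zero    h = ≋-refl
  Δ^[p^e]≋Δ[p^e] (suc e) h = begin
    Δ ^[ p * p ^ e ] h             ≡⟨ ^[]-* Δ p (p ^ e) h ⟩
    (Δ ^[ p ^ e ]_) ^[ p ] h       ≈⟨ ^[]-cong ≋-setoid step p ≋-refl ⟩
    Δ[ p ^ e ] ^[ p ] h            ≈⟨ frobenius (p ^ e) h ⟩
    Δ[ p ^ e * p ] h               ≡⟨ cong (λ c → Δ[ c ] h) (*-comm (p ^ e) p) ⟩
    Δ[ p * p ^ e ] h               ∎
    where
      open SetoidReasoning ≋-setoid
      step : ∀ {h h′} → h ≋ h′ → Δ ^[ p ^ e ] h ≋ Δ[ p ^ e ] h′
      step {h′ = h′} e′ = ≋-trans (Δ[]^-cong 1 (p ^ e) e′) (Δ^[p^e]≋Δ[p^e] e h′)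

  Degree< : ℕ → Seq → Set
  Degree< k h = ∀ j → k ≤ j → Δ ^[ j ] h ≋ const 0

  Degree<-mono : ∀ {k k′ h} → k ≤ k′ → Degree< k h → Degree< k′ h
  Degree<-mono k≤k′ deg j k′≤j = deg j (≤-trans k≤k′ k′≤j)

  Degree<-Δ^ : ∀ k q {h} → Degree< (q + k) h → Degree< k (Δ ^[ q ] h)
  Degree<-Δ^ k q {h} deg j k≤j =
    ≋-trans (≡⇒≋ (sym (^[]-+ Δ j q h))) (deg (j + q) (≤-trans (≤-reflexive (+-comm q k)) (+-monoˡ-≤ q k≤j)))

  Δ^-shift : ∀ k h → Δ ^[ k ] shift h ≡ shift (Δ ^[ k ] h)
  Δ^-shift zero    h = refl
  Δ^-shift (suc k) h = cong Δ (Δ^-shift k h)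

  Degree<-shift : ∀ {k h} → Degree< k h → Degree< k (shift h)
  Degree<-shift {h = h} deg j k≤j = mk≋ λ u → ≈-trans (≡⇒≈ (cong (λ g → g u) (Δ^-shift j h))) (at (deg j k≤j) (suc u))

  periodic⇒Degree< : ∀ e h → (∀ u → h (u + p ^ e) ≡ h u) → Degree< (p ^ e) h
  periodic⇒Degree< e h periodic j pᵉ≤j with m≤n⇒∃[o]m+o≡n pᵉ≤j
  ... | o , refl = begin
    Δ ^[ p ^ e + o ] h          ≡⟨ cong (λ n → Δ ^[ n ] h) (+-comm (p ^ e) o) ⟩
    Δ ^[ o + p ^ e ] h          ≡⟨ ^[]-+ Δ o (p ^ e) h ⟩
    Δ ^[ o ] Δ ^[ p ^ e ] h     ≈⟨ Δ[]^-cong 1 o (≋-trans (Δ^[p^e]≋Δ[p^e] e h) Δ[pᵉ]h≋0) ⟩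
    Δ ^[ o ] const 0            ≈⟨ Δ[]^-zero 1 o ⟩
    const 0                     ∎
    where
      open SetoidReasoning ≋-setoid
      Δ[pᵉ]h≋0 : Δ[ p ^ e ] h ≋ const 0
      Δ[pᵉ]h≋0 = mk≋ λ u → ≈-trans (≡⇒≈ (cong (_+ p-1 * h u) (periodic u))) (x+[p-1]x≈0 (h u))

  2≤pᵉ : ∀ {e} → 1 ≤ e → 2 ≤ p ^ e
  2≤pᵉ 1≤e = ≤-trans 1<p (≤-trans (≤-reflexive (sym (*-identityʳ p))) (^-monoʳ-≤ p 1≤e))

  ⊕-cong : ∀ {h h′ g g′} → h ≋ h′ → g ≋ g′ → h ⊕ g ≋ h′ ⊕ g′
  ⊕-cong e e′ = mk≋ λ u → +-cong (at e u) (at e′ u)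

  module _ (e : ℕ) (1≤e : 1 ≤ e) where

    private
      q = p ^ e

    Δ[1+pᵉ]≋Δ⊕shift : ∀ h → Δ[ suc q ] h ≋ Δ h ⊕ shift (Δ ^[ q ] h)
    Δ[1+pᵉ]≋Δ⊕shift h = mk≋ λ u → begin
      h (u + suc q) + p-1 * h u
        ≡⟨ cong (λ z → h z + p-1 * h u) (+-suc u q) ⟩
      h (suc u + q) + p-1 * h u
        ≈⟨ x+d*y≈x _ (h (suc u)) ⟨
      h (suc u + q) + p-1 * h u + p * h (suc u)
        ≡⟨ cong (λ n → h (suc u + q) + p-1 * h u + n * h (suc u)) (suc-pred p) ⟨
      h (suc u + q) + p-1 * h u + suc p-1 * h (suc u)
        ≡⟨ rearrange (h (suc u + q)) (h u) (h (suc u)) p-1 ⟩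
      h (suc u) + p-1 * h u + (h (suc u + q) + p-1 * h (suc u))
        ≡⟨ cong (λ z → h z + p-1 * h u + (h (suc u + q) + p-1 * h (suc u))) (+-comm 1 u) ⟩
      Δ h u + Δ[ q ] h (suc u)
        ≈⟨ +-cong {Δ h u} ≈-refl (≈-sym (at (Δ^[p^e]≋Δ[p^e] e h) (suc u))) ⟩
      Δ h u + shift (Δ ^[ q ] h) u
        ∎
      where
        open SetoidReasoning ≈-setoid
        rearrange : ∀ a b c w → a + w * b + suc w * c ≡ c + w * b + (a + w * c)
        rearrange = solve-∀

    -- Since q ≥ 2, Δ ^[ i ] kills the correction term shift (Δ ^[ q ] h) of Δ[1+pᵉ]≋Δ⊕shift.
    Δ[1+pᵉ]^≋Δ^ : ∀ i h → Degree< (suc i) h → Δ[ suc q ] ^[ i ] h ≋ Δ ^[ i ] h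
    Δ[1+pᵉ]^≋Δ^ zero    h _   = ≋-refl
    Δ[1+pᵉ]^≋Δ^ (suc i) h deg = begin
      Δ[ suc q ] ^[ suc i ] h                            ≡⟨ ^[]-suc Δ[ suc q ] i h ⟩
      Δ[ suc q ] ^[ i ] Δ[ suc q ] h                     ≈⟨ Δ[]^-cong (suc q) i (Δ[1+pᵉ]≋Δ⊕shift h) ⟩
      Δ[ suc q ] ^[ i ] (Δ h ⊕ g)                        ≈⟨ Δ[]^-⊕ (suc q) i (Δ h) g ⟩
      Δ[ suc q ] ^[ i ] Δ h ⊕ Δ[ suc q ] ^[ i ] g        ≈⟨ ⊕-cong (Δ[1+pᵉ]^≋Δ^ i (Δ h) (Degree<-Δ^ (suc i) 1 deg))
                                                                   (Δ[1+pᵉ]^≋Δ^ i g (Degree<-mono (n≤1+n i) deg-g)) ⟩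
      Δ ^[ i ] Δ h ⊕ Δ ^[ i ] g                          ≈⟨ ⊕-cong ≋-refl (deg-g i ≤-refl) ⟩
      Δ ^[ i ] Δ h ⊕ const 0                             ≈⟨ mk≋ (λ u → ≡⇒≈ (+-identityʳ _)) ⟩
      Δ ^[ i ] Δ h                                       ≡⟨ ^[]-suc Δ i h ⟨
      Δ ^[ suc i ] h                                     ∎
      where
        open SetoidReasoning ≋-setoid
        g = shift (Δ ^[ q ] h)
        deg-g : Degree< i g
        deg-g = Degree<-shift (Degree<-Δ^ i q (Degree<-mono (+-monoˡ-≤ i (2≤pᵉ 1≤e)) deg))

module GridDifferences (p : ℕ) (p-prime : Prime p) where

  open ≡ using (refl; sym; trans; cong; cong₂; subst)

  open FiniteDifferences p p-prime public

  Grid : Set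
  Grid = ℕ → ℕ → ℕ

  0₂ : Grid
  0₂ _ _ = 0

  infixl 6 _⊞_
  infixl 7 _⊡_

  _⊞_ : Grid → Grid → Grid
  (f ⊞ g) v u = f v u + g v u

  _⊡_ : ℕ → Grid → Grid
  (c ⊡ f) v u = c * f v u

  ⊞-cong : ∀ {f f′ g g′} → f ≋₂ f′ → g ≋₂ g′ → f ⊞ g ≋₂ f′ ⊞ g′
  ⊞-cong e e′ = mk≋₂ λ v u → +-cong (at₂ e v u) (at₂ e′ v u)

  transpose : Grid → Grid
  transpose f v u = f u v

  X[_] : ℕ → Grid → Grid
  X[ c ] f v = Δ[ c ] (f v)

  X Y : Grid → Grid
  X = X[ 1 ]
  Y = transpose ∘ X ∘ transpose

  X[]^-row : ∀ c i f v → (X[ c ] ^[ i ] f) v ≡ Δ[ c ] ^[ i ] (f v)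
  X[]^-row c zero    f v = refl
  X[]^-row c (suc i) f v = cong Δ[ c ] (X[]^-row c i f v)

  Y^-column : ∀ j f v u → (Y ^[ j ] f) v u ≡ (Δ ^[ j ] transpose f u) v
  Y^-column j f v u = trans (cong (λ g → g v u) (Y^-transpose j)) (cong (λ h → h v) (X[]^-row 1 j (transpose f) u))
    where
      Y^-transpose : ∀ j → Y ^[ j ] f ≡ transpose (X ^[ j ] transpose f)
      Y^-transpose zero    = refl
      Y^-transpose (suc j) = cong Y (Y^-transpose j)

  record IsLinear (A : Grid → Grid) : Set where
    field
      ≋₂-cong : ∀ {f g} → f ≋₂ g → A f ≋₂ A g
      ⊞-homo : ∀ f g → A (f ⊞ g) ≋₂ A f ⊞ A g
      ⊡-homo : ∀ c f → A (c ⊡ f) ≋₂ c ⊡ A f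

  ∘-isLinear : ∀ {A B} → IsLinear A → IsLinear B → IsLinear (A ∘ B)
  ∘-isLinear {A} {B} linA linB = record
    { ≋₂-cong = A.≋₂-cong ∘ B.≋₂-cong
    ; ⊞-homo = λ f g → ≋₂-trans (A.≋₂-cong (B.⊞-homo f g)) (A.⊞-homo (B f) (B g))
    ; ⊡-homo = λ c f → ≋₂-trans (A.≋₂-cong (B.⊡-homo c f)) (A.⊡-homo c (B f))
    }
    where
      module A = IsLinear linA
      module B = IsLinear linB

  ^[]-isLinear : ∀ {A} → IsLinear A → ∀ k → IsLinear (A ^[ k ]_)
  ^[]-isLinear linA zero    = record
    { ≋₂-cong = λ e → e ; ⊞-homo = λ _ _ → ≋₂-refl ; ⊡-homo = λ _ _ → ≋₂-refl }
  ^[]-isLinear linA (suc k) = ∘-isLinear linA (^[]-isLinear linA k)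

  transpose-isLinear : ∀ {A} → IsLinear A → IsLinear (transpose ∘ A ∘ transpose)
  transpose-isLinear linA = record
    { ≋₂-cong = λ e → mk≋₂ λ v u → at₂ (≋₂-cong (mk≋₂ λ v′ u′ → at₂ e u′ v′)) u v
    ; ⊞-homo = λ f g → mk≋₂ λ v u → at₂ (⊞-homo (transpose f) (transpose g)) u v
    ; ⊡-homo = λ c f → mk≋₂ λ v u → at₂ (⊡-homo c (transpose f)) u v
    }
    where open IsLinear linA

  X-isLinear : IsLinear X
  X-isLinear = record
    { ≋₂-cong = λ e → mk≋₂ λ v → at (Δ[]-cong 1 (mk≋ (at₂ e v)))
    ; ⊞-homo = λ f g → mk≋₂ λ v → at (Δ[]-⊕ 1 (f v) (g v))
    ; ⊡-homo = λ c f → mk≋₂ λ v u → ≡⇒≈ (distrib c (f v (u + 1)) (f v u) p-1)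
    }
    where
      distrib : ∀ c x y w → c * x + w * (c * y) ≡ c * (x + w * y)
      distrib = solve-∀

  Y-isLinear : IsLinear Y
  Y-isLinear = transpose-isLinear X-isLinear

  XY≋YX : ∀ f → X (Y f) ≋₂ Y (X f)
  XY≋YX f = mk≋₂ λ v u → ≡⇒≈ (swap (f (v + 1) (u + 1)) (f v (u + 1)) (f (v + 1) u) (f v u) p-1)
    where
      swap : ∀ a b c d w → a + w * b + w * (c + w * d) ≡ a + w * c + w * (b + w * d)
      swap = solve-∀

  ^[]-commute : ∀ {A B} → IsLinear A → IsLinear B → (∀ f → A (B f) ≋₂ B (A f)) →
                ∀ i j f → A ^[ i ] B ^[ j ] f ≋₂ B ^[ j ] A ^[ i ] f
  ^[]-commute {A} {B} linA linB AB≋BA = A^B^≋B^A^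
    where
      AB^≋B^A : ∀ j f → A (B ^[ j ] f) ≋₂ B ^[ j ] A f
      AB^≋B^A zero    f = ≋₂-refl
      AB^≋B^A (suc j) f = ≋₂-trans (AB≋BA (B ^[ j ] f)) (IsLinear.≋₂-cong linB (AB^≋B^A j f))
      A^B^≋B^A^ : ∀ i j f → A ^[ i ] B ^[ j ] f ≋₂ B ^[ j ] A ^[ i ] f
      A^B^≋B^A^ zero    j f = ≋₂-refl
      A^B^≋B^A^ (suc i) j f = ≋₂-trans (IsLinear.≋₂-cong linA (A^B^≋B^A^ i j f)) (AB^≋B^A j (A ^[ i ] f))

  X^Y^≋Y^X^ : ∀ i j f → X ^[ i ] Y ^[ j ] f ≋₂ Y ^[ j ] X ^[ i ] f
  X^Y^≋Y^X^ = ^[]-commute X-isLinear Y-isLinear XY≋YX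

  ∂ : ℕ → ℕ → Grid → Grid
  ∂ i j f = X ^[ i ] Y ^[ j ] f

  ∂-isLinear : ∀ i j → IsLinear (∂ i j)
  ∂-isLinear i j = ∘-isLinear (^[]-isLinear X-isLinear i) (^[]-isLinear Y-isLinear j)

  Degree₂< : ℕ → Grid → Set
  Degree₂< k f = ∀ i j → k ≤ i + j → ∂ i j f ≋₂ 0₂

  Degree₂<-cong : ∀ {k f g} → f ≋₂ g → Degree₂< k f → Degree₂< k g
  Degree₂<-cong {f = f} {g} f≋g deg i j k≤i+j =
    ≋₂-trans (IsLinear.≋₂-cong (∂-isLinear i j) (≋₂-sym f≋g)) (deg i j k≤i+j)

  Degree₂<-⊞ : ∀ {k f g} → Degree₂< k f → Degree₂< k g → Degree₂< k (f ⊞ g)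
  Degree₂<-⊞ {f = f} {g} deg-f deg-g i j k≤i+j = ≋₂-trans (IsLinear.⊞-homo (∂-isLinear i j) f g)
    (mk≋₂ λ v u → +-cong (at₂ (deg-f i j k≤i+j) v u) (at₂ (deg-g i j k≤i+j) v u))

  Degree₂<-suc : ∀ {k f} → Degree₂< k f → Degree₂< (suc k) f
  Degree₂<-suc deg i j 1+k≤i+j = deg i j (<⇒≤ 1+k≤i+j)

  Degree₂<-0 : ∀ {k f} → f ≋₂ 0₂ → Degree₂< k f
  Degree₂<-0 {f = f} f≋0 i j _ =
    ≋₂-trans (IsLinear.≋₂-cong (∂-isLinear i j) f≋0) (IsLinear.⊡-homo (∂-isLinear i j) 0 0₂)

  Degree₂<-X : ∀ {k f} → Degree₂< (suc k) f → Degree₂< k (X f)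
  Degree₂<-X {f = f} deg i j k≤i+j = begin
    X ^[ i ] Y ^[ j ] X f      ≈⟨ IsLinear.≋₂-cong (^[]-isLinear X-isLinear i) (≋₂-sym (X^Y^≋Y^X^ 1 j f)) ⟩
    X ^[ i ] X (Y ^[ j ] f)    ≡⟨ ^[]-suc X i (Y ^[ j ] f) ⟨
    ∂ (suc i) j f              ≈⟨ deg (suc i) j (s≤s k≤i+j) ⟩
    0₂                         ∎
    where open SetoidReasoning ≋₂-setoid

  Lowers : (Grid → Grid) → Set
  Lowers A = ∀ k f → Degree₂< (suc k) f → Degree₂< k (A f ⊞ p-1 ⊡ f)

  x+[p-1]x≋0 : ∀ f → f ⊞ p-1 ⊡ f ≋₂ 0₂
  x+[p-1]x≋0 f = mk≋₂ λ v u → x+[p-1]x≈0 (f v u)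

  -- A B - 1 = (A - 1) B + (B - 1), where B f still has degree < k + 1.
  Lowers-∘ : ∀ {A B} → Lowers A → Lowers B → Lowers (A ∘ B)
  Lowers-∘ {A} {B} lowA lowB k f deg-f = Degree₂<-cong sum≋ (Degree₂<-⊞ (lowA k (B f) deg-Bf) deg-Bf-f)
    where
      regroup₁ : ∀ b x w → b + w * x + x ≡ b + (x + w * x)
      regroup₁ = solve-∀
      regroup₂ : ∀ a b x w → a + w * b + (b + w * x) ≡ a + w * x + (b + w * b)
      regroup₂ = solve-∀
      deg-Bf-f : Degree₂< k (B f ⊞ p-1 ⊡ f)
      deg-Bf-f = lowB k f deg-f
      deg-Bf : Degree₂< (suc k) (B f)
      deg-Bf = Degree₂<-cong (mk≋₂ λ v u → ≈-trans (≡⇒≈ (regroup₁ (B f v u) (f v u) p-1))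
                                                  (y+[x+[p-1]x]≈y (B f v u) (f v u)))
                             (Degree₂<-⊞ (Degree₂<-suc deg-Bf-f) deg-f)
      sum≋ : A (B f) ⊞ p-1 ⊡ B f ⊞ (B f ⊞ p-1 ⊡ f) ≋₂ A (B f) ⊞ p-1 ⊡ f
      sum≋ = mk≋₂ λ v u → ≈-trans (≡⇒≈ (regroup₂ (A (B f) v u) (B f v u) (f v u) p-1))
                                  (y+[x+[p-1]x]≈y (A (B f) v u + p-1 * f v u) (B f v u))

  Lowers-id : Lowers (λ f → f)
  Lowers-id k f _ = Degree₂<-0 (x+[p-1]x≋0 f)

  Lowers-^[] : ∀ {A} → Lowers A → ∀ k → Lowers (A ^[ k ]_)
  Lowers-^[] lowA zero    = Lowers-id
  Lowers-^[] lowA (suc k) = Lowers-∘ lowA (Lowers-^[] lowA k)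

  Lowers-cong : ∀ {A B} → (∀ f → A f ≋₂ B f) → Lowers B → Lowers A
  Lowers-cong A≋B lowB k f deg = Degree₂<-cong (mk≋₂ λ v u → +-cong (≈-sym (at₂ (A≋B f) v u)) ≈-refl) (lowB k f deg)

  constant : ∀ {g} → X g ≋₂ 0₂ → Y g ≋₂ 0₂ → ∀ v u → g v u ≈ g 0 0
  constant {g} Xg≋0 Yg≋0 v u = ≈-trans (along-row v u) (along-column v)
    where
      along-row : ∀ v u → g v u ≈ g v 0
      along-row v zero    = ≈-refl
      along-row v (suc u) =
        ≈-trans (≈-trans (≡⇒≈ (cong (g v) (+-comm 1 u))) (x+[p-1]y≈0⇒x≈y (at₂ Xg≋0 v u))) (along-row v u)
      along-column : ∀ v → g v 0 ≈ g 0 0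
      along-column zero    = ≈-refl
      along-column (suc v) =
        ≈-trans (≈-trans (≡⇒≈ (cong (λ v′ → g v′ 0) (+-comm 1 v))) (x+[p-1]y≈0⇒x≈y (at₂ Yg≋0 v 0))) (along-column v)

  Periodic : ℕ → ℕ → Grid → Set
  Periodic m n f = (∀ v u → f (v + m) u ≡ f v u) × (∀ v u → f v (u + n) ≡ f v u)

  Y^-periodicᵘ : ∀ {n f} → (∀ v u → f v (u + n) ≡ f v u) → ∀ j v u → (Y ^[ j ] f) v (u + n) ≡ (Y ^[ j ] f) v u
  Y^-periodicᵘ per zero    v u = per v u
  Y^-periodicᵘ per (suc j) v u = cong₂ (λ a b → a + p-1 * b) (Y^-periodicᵘ per j (v + 1) u) (Y^-periodicᵘ per j v u)

  X^-periodicᵛ : ∀ {m f} → (∀ v u → f (v + m) u ≡ f v u) → ∀ i v u → (X ^[ i ] f) (v + m) u ≡ (X ^[ i ] f) v u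
  X^-periodicᵛ per zero    v u = per v u
  X^-periodicᵛ per (suc i) v u = cong₂ (λ a b → a + p-1 * b) (X^-periodicᵛ per i v (u + 1)) (X^-periodicᵛ per i v u)

  periodic⇒Degree₂< : ∀ α β f → Periodic (p ^ β) (p ^ α) f → Degree₂< (pred (p ^ α) + p ^ β) f
  periodic⇒Degree₂< α β f (perᵛ , perᵘ) i j le with p ^ α ≤? i
  ... | yes pᵅ≤i = mk≋₂ λ v u →
    ≈-trans (≡⇒≈ (cong (λ h → h u) (X[]^-row 1 i (Y ^[ j ] f) v)))
            (at (periodic⇒Degree< α ((Y ^[ j ] f) v) (Y^-periodicᵘ perᵘ j v) i pᵅ≤i) u)
  ... | no  pᵅ≰i = ≋₂-trans (X^Y^≋Y^X^ i j f) (mk≋₂ λ v u →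
    ≈-trans (≡⇒≈ (Y^-column j (X ^[ i ] f) v u))
            (at (periodic⇒Degree< β (transpose (X ^[ i ] f) u) (λ v → X^-periodicᵛ perᵛ i v u) j pᵝ≤j) v))
    where
      pᵝ≤j : p ^ β ≤ j
      pᵝ≤j = +-cancelˡ-≤ (pred (p ^ α)) (p ^ β) j (≤-trans le (+-monoˡ-≤ j (<⇒≤pred (≰⇒> pᵅ≰i))))

  module Translations (e : ℕ) (1≤e : 1 ≤ e) where

    r : ℕ
    r = suc (p ^ e)

    -- Right multiplication by bʲ aⁱ, read on the coordinates (v , u) of bᵛ aᵘ.
    ρ : ℕ → ℕ → Grid → Grid
    ρ j i f v u = f (v + j) (u * r ^ j + i)

    ρᵃ ρᵇ : Grid → Grid
    ρᵃ f v u = f v (u + 1)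
    ρᵇ f v u = f (v + 1) (u * r)

    ρ≡ρᵇ^ρᵃ^ : ∀ j i f v u → ρ j i f v u ≡ (ρᵇ ^[ j ] ρᵃ ^[ i ] f) v u
    ρ≡ρᵇ^ρᵃ^ j i f v u = sym (trans (ρᵇ^ j (ρᵃ ^[ i ] f) v u) (ρᵃ^ i f (v + j) (u * r ^ j)))
      where
        ρᵃ^ : ∀ i f v u → (ρᵃ ^[ i ] f) v u ≡ f v (u + i)
        ρᵃ^ zero    f v u = cong (f v) (sym (+-identityʳ u))
        ρᵃ^ (suc i) f v u = trans (ρᵃ^ i f v (u + 1)) (cong (f v) (+-assoc u 1 i))
        ρᵇ^ : ∀ j f v u → (ρᵇ ^[ j ] f) v u ≡ f (v + j) (u * r ^ j)
        ρᵇ^ zero    f v u = cong₂ f (sym (+-identityʳ v)) (sym (*-identityʳ u))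
        ρᵇ^ (suc j) f v u = trans (ρᵇ^ j f (v + 1) (u * r)) (cong₂ f (+-assoc v 1 j) (*-assoc u r (r ^ j)))

    Lowers-ρᵃ : Lowers ρᵃ
    Lowers-ρᵃ k f = Degree₂<-X

    Y^-ρᵇ : ∀ j f → Y ^[ j ] ρᵇ f ≡ ρᵇ (Y ^[ j ] f)
    Y^-ρᵇ zero    f = refl
    Y^-ρᵇ (suc j) f = cong Y (Y^-ρᵇ j f)

    X^-ρᵇ : ∀ i g → X ^[ i ] ρᵇ g ≋₂ ρᵇ (X[ r ] ^[ i ] g)
    X^-ρᵇ zero    g = ≋₂-refl
    X^-ρᵇ (suc i) g = ≋₂-trans (IsLinear.≋₂-cong X-isLinear (X^-ρᵇ i g)) (mk≋₂ λ v u →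
      ≡⇒≈ (cong (λ z → (X[ r ] ^[ i ] g) (v + 1) z + p-1 * (X[ r ] ^[ i ] g) (v + 1) (u * r))
                (trans (*-distribʳ-+ r u 1) (cong (u * r +_) (*-identityˡ r)))))

    X[r]^≋X^ : ∀ i g → (∀ i′ → i < i′ → X ^[ i′ ] g ≋₂ 0₂) → X[ r ] ^[ i ] g ≋₂ X ^[ i ] g
    X[r]^≋X^ i g vanish = mk≋₂ λ v → at (row v)
      where
        row : ∀ v → (X[ r ] ^[ i ] g) v ≋ (X ^[ i ] g) v
        row v = begin
          (X[ r ] ^[ i ] g) v    ≡⟨ X[]^-row r i g v ⟩
          Δ[ r ] ^[ i ] (g v)    ≈⟨ Δ[1+pᵉ]^≋Δ^ e 1≤e i (g v) row-degree ⟩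
          Δ ^[ i ] (g v)         ≡⟨ X[]^-row 1 i g v ⟨
          (X ^[ i ] g) v         ∎
          where
            open SetoidReasoning ≋-setoid
            row-degree : Degree< (suc i) (g v)
            row-degree i′ i<i′ = ≋-trans (≡⇒≋ (sym (X[]^-row 1 i′ g v))) (mk≋ (at₂ (vanish i′ i<i′) v))

    -- X[ r ] ^[ i ] agrees with X ^[ i ] on the relevant functions, so ∂ i j (ρᵇ f) ≋ ρᵇ (∂ i j f);
    -- and ∂ i j f is constant when i + j = k.
    Lowers-ρᵇ : Lowers ρᵇ
    Lowers-ρᵇ k f deg i j k≤i+j = begin
      ∂ i j (ρᵇ f ⊞ p-1 ⊡ f)            ≈⟨ IsLinear.⊞-homo ∂ᵢⱼ (ρᵇ f) (p-1 ⊡ f) ⟩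
      ∂ i j (ρᵇ f) ⊞ ∂ i j (p-1 ⊡ f)    ≈⟨ ⊞-cong ≋₂-refl (IsLinear.⊡-homo ∂ᵢⱼ p-1 f) ⟩
      X ^[ i ] Y ^[ j ] ρᵇ f ⊞ p-1 ⊡ g₀ ≡⟨ cong (λ h → X ^[ i ] h ⊞ p-1 ⊡ g₀) (Y^-ρᵇ j f) ⟩
      X ^[ i ] ρᵇ g ⊞ p-1 ⊡ g₀          ≈⟨ ⊞-cong (X^-ρᵇ i g) ≋₂-refl ⟩
      ρᵇ (X[ r ] ^[ i ] g) ⊞ p-1 ⊡ g₀   ≈⟨ ⊞-cong (mk≋₂ λ v u → at₂ X[r]^g≋g₀ (v + 1) (u * r)) ≋₂-refl ⟩
      ρᵇ g₀ ⊞ p-1 ⊡ g₀                  ≈⟨ mk≋₂ (λ v u → +-cong (constant Xg₀≋0 Yg₀≋0 (v + 1) (u * r))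
                                                             (*-congˡ p-1 (constant Xg₀≋0 Yg₀≋0 v u))) ⟩
      (λ _ _ → g₀ 0 0 + p-1 * g₀ 0 0)   ≈⟨ mk≋₂ (λ _ _ → x+[p-1]x≈0 (g₀ 0 0)) ⟩
      0₂                                ∎
      where
        open SetoidReasoning ≋₂-setoid
        ∂ᵢⱼ = ∂-isLinear i j
        g = Y ^[ j ] f
        g₀ = ∂ i j f
        X[r]^g≋g₀ : X[ r ] ^[ i ] g ≋₂ g₀
        X[r]^g≋g₀ = X[r]^≋X^ i g λ i′ i<i′ → deg i′ j (≤-trans (s≤s k≤i+j) (+-monoˡ-≤ j i<i′))
        Xg₀≋0 : X g₀ ≋₂ 0₂
        Xg₀≋0 = deg (suc i) j (s≤s k≤i+j)
        Yg₀≋0 : Y g₀ ≋₂ 0₂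
        Yg₀≋0 = ≋₂-trans (≋₂-sym (X^Y^≋Y^X^ i 1 g))
                         (deg i (suc j) (≤-trans (s≤s k≤i+j) (≤-reflexive (sym (+-suc i j)))))

    Lowers-ρ : ∀ j i → Lowers (ρ j i)
    Lowers-ρ j i = Lowers-cong (λ f → mk≋₂ λ v u → ≡⇒≈ (ρ≡ρᵇ^ρᵃ^ j i f v u))
                               (Lowers-∘ (Lowers-^[] Lowers-ρᵇ j) (Lowers-^[] Lowers-ρᵃ i))

    ∏[ρ-1] : List (ℕ × ℕ) → Grid → Grid
    ∏[ρ-1] []            f = f
    ∏[ρ-1] ((j , i) ∷ l) f = ρ j i (∏[ρ-1] l f) ⊞ p-1 ⊡ ∏[ρ-1] l f

    ∏[ρ-1]-Degree₂< : ∀ l k f → Degree₂< (length l + k) f → Degree₂< k (∏[ρ-1] l f)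
    ∏[ρ-1]-Degree₂< []            k f deg = deg
    ∏[ρ-1]-Degree₂< ((j , i) ∷ l) k f deg =
      Lowers-ρ j i k (∏[ρ-1] l f)
        (∏[ρ-1]-Degree₂< l (suc k) f (subst (λ n → Degree₂< n f) (sym (+-suc (length l) k)) deg))

    ∏[ρ-1]-periodic≈0 : ∀ α β l f → Periodic (p ^ β) (p ^ α) f → length l ≡ pred (p ^ α) + p ^ β →
                        ∏[ρ-1] l f 0 0 ≈ 0
    ∏[ρ-1]-periodic≈0 α β l f per len = at₂ (∏[ρ-1]-Degree₂< l 0 f deg 0 0 z≤n) 0 0
      where
        deg : Degree₂< (length l + 0) f
        deg = subst (λ n → Degree₂< n f) (sym (trans (+-identityʳ (length l)) len)) (periodic⇒Degree₂< α β f per)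

module PowerLaws {c ℓ : Level} (G : Group c ℓ) where

  open Group G
  open GroupDefs G
  open import Relation.Binary.Reasoning.Setoid setoid

  pow-+ : ∀ x i j → pow x (i + j) ≈ pow x i ∙ pow x j
  pow-+ x zero    j = sym (identityˡ _)
  pow-+ x (suc i) j = trans (∙-congˡ (pow-+ x i j)) (sym (assoc _ _ _))

  pow-* : ∀ x i j → pow x (i * j) ≈ pow (pow x j) i
  pow-* x zero    j = refl
  pow-* x (suc i) j = trans (pow-+ x j (i * j)) (∙-congˡ (pow-* x i j))

  pow-congˡ : ∀ {x y} k → x ≈ y → pow x k ≈ pow y k
  pow-congˡ zero    x≈y = refl
  pow-congˡ (suc k) x≈y = ∙-cong x≈y (pow-congˡ k x≈y)

  pow-ε : ∀ k → pow ε k ≈ ε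
  pow-ε zero    = refl
  pow-ε (suc k) = trans (identityˡ _) (pow-ε k)

  ∙-comm-up-to-comm : ∀ x y → x ∙ y ≈ (y ∙ x) ∙ comm x y
  ∙-comm-up-to-comm x y = sym (begin
    (y ∙ x) ∙ (((x ⁻¹ ∙ y ⁻¹) ∙ x) ∙ y)    ≈⟨ ∙-congˡ (assoc _ _ _) ⟩
    (y ∙ x) ∙ ((x ⁻¹ ∙ y ⁻¹) ∙ (x ∙ y))    ≈⟨ ∙-congˡ (∙-congʳ (⁻¹-anti-homo-∙ y x)) ⟨
    (y ∙ x) ∙ ((y ∙ x) ⁻¹ ∙ (x ∙ y))       ≈⟨ assoc _ _ _ ⟨
    ((y ∙ x) ∙ (y ∙ x) ⁻¹) ∙ (x ∙ y)       ≈⟨ ∙-congʳ (inverseʳ (y ∙ x)) ⟩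
    ε ∙ (x ∙ y)                            ≈⟨ identityˡ _ ⟩
    x ∙ y                                  ∎)
    where open GroupProperties G using (⁻¹-anti-homo-∙)

  module Order {x : Carrier} {n : ℕ} (x-order : HasOrder x n) where

    instance
      n≢0 : NonZero n
      n≢0 = >-nonZero (proj₁ x-order)

    pow-multiple : ∀ k → pow x (k * n) ≈ ε
    pow-multiple k = trans (pow-* x k n) (trans (pow-congˡ k (proj₁ (proj₂ x-order))) (pow-ε k))

    pow-% : ∀ k → pow x k ≈ pow x (k % n)
    pow-% k = begin
      pow x k                              ≡⟨ ≡.cong (pow x) (m≡m%n+[m/n]*n k n) ⟩
      pow x (k % n + k / n * n)            ≈⟨ pow-+ x (k % n) (k / n * n) ⟩
      pow x (k % n) ∙ pow x (k / n * n)    ≈⟨ ∙-congˡ (pow-multiple (k / n)) ⟩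
      pow x (k % n) ∙ ε                    ≈⟨ identityʳ _ ⟩
      pow x (k % n)                        ∎

    pow≈ε⇒%≡0 : ∀ k → pow x k ≈ ε → k % n ≡ 0
    pow≈ε⇒%≡0 k xᵏ≈ε with k % n in k%n≡
    ... | zero  = ≡.refl
    ... | suc t = ⊥-elim (proj₂ (proj₂ x-order) (suc t) (s≤s z≤n) (≡.subst (_< n) k%n≡ (m%n<n k n))
                           (trans (sym (≡.subst (λ z → pow x k ≈ pow x z) k%n≡ (pow-% k))) xᵏ≈ε))

    %≡0⇒pow≈ε : ∀ k → k % n ≡ 0 → pow x k ≈ ε
    %≡0⇒pow≈ε k k%n≡0 = trans (pow-% k) (≡.subst (λ z → pow x z ≈ ε) (≡.sym k%n≡0) refl)

module Metacyclic {c ℓ : Level} (G : Group c ℓ) (a b : Group.Carrier G) (n m q : ℕ)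
                  (semidirect : GroupDefs.IsSemidirectCyclic G a b)
                  (commutator : Group._≈_ G (GroupDefs.comm G a b) (GroupDefs.pow G a q))
                  (a-order : GroupDefs.HasOrder G a n) (b-order : GroupDefs.HasOrder G b m) where

  open Group G
  open GroupDefs G
  open PowerLaws G
  open import Relation.Binary.Reasoning.Setoid setoid
  private
    module A = Order a-order
    module B = Order b-order

  instance
    n≢0 : NonZero n
    n≢0 = A.n≢0
    m≢0 : NonZero m
    m≢0 = B.n≢0

  r : ℕ
  r = suc q

  a∙b≈b∙aʳ : a ∙ b ≈ b ∙ pow a r
  a∙b≈b∙aʳ = begin
    a ∙ b                ≈⟨ ∙-comm-up-to-comm a b ⟩
    (b ∙ a) ∙ comm a b   ≈⟨ ∙-congˡ commutator ⟩
    (b ∙ a) ∙ pow a q    ≈⟨ assoc _ _ _ ⟩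
    b ∙ pow a r          ∎

  aᵘ∙b≈b∙aᵘʳ : ∀ u → pow a u ∙ b ≈ b ∙ pow a (u * r)
  aᵘ∙b≈b∙aᵘʳ zero    = trans (identityˡ b) (sym (identityʳ b))
  aᵘ∙b≈b∙aᵘʳ (suc u) = begin
    (a ∙ pow a u) ∙ b            ≈⟨ assoc _ _ _ ⟩
    a ∙ (pow a u ∙ b)            ≈⟨ ∙-congˡ (aᵘ∙b≈b∙aᵘʳ u) ⟩
    a ∙ (b ∙ pow a (u * r))      ≈⟨ assoc _ _ _ ⟨
    (a ∙ b) ∙ pow a (u * r)      ≈⟨ ∙-congʳ a∙b≈b∙aʳ ⟩
    (b ∙ pow a r) ∙ pow a (u * r) ≈⟨ assoc _ _ _ ⟩
    b ∙ (pow a r ∙ pow a (u * r)) ≈⟨ ∙-congˡ (pow-+ a r (u * r)) ⟨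
    b ∙ pow a (r + u * r)        ∎

  aᵘ∙bʲ≈bʲ∙aᵘʳʲ : ∀ u j → pow a u ∙ pow b j ≈ pow b j ∙ pow a (u * r ^ j)
  aᵘ∙bʲ≈bʲ∙aᵘʳʲ u zero    =
    trans (identityʳ _) (trans (reflexive (≡.cong (pow a) (≡.sym (*-identityʳ u)))) (sym (identityˡ _)))
  aᵘ∙bʲ≈bʲ∙aᵘʳʲ u (suc j) = begin
    pow a u ∙ (b ∙ pow b j)                ≈⟨ assoc _ _ _ ⟨
    (pow a u ∙ b) ∙ pow b j                ≈⟨ ∙-congʳ (aᵘ∙b≈b∙aᵘʳ u) ⟩
    (b ∙ pow a (u * r)) ∙ pow b j          ≈⟨ assoc _ _ _ ⟩
    b ∙ (pow a (u * r) ∙ pow b j)          ≈⟨ ∙-congˡ (aᵘ∙bʲ≈bʲ∙aᵘʳʲ (u * r) j) ⟩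
    b ∙ (pow b j ∙ pow a (u * r * r ^ j))  ≈⟨ assoc _ _ _ ⟨
    (b ∙ pow b j) ∙ pow a (u * r * r ^ j)  ≡⟨ ≡.cong (λ k → (b ∙ pow b j) ∙ pow a k) (*-assoc u r (r ^ j)) ⟩
    (b ∙ pow b j) ∙ pow a (u * r ^ suc j)  ∎

  record Coords (x : Carrier) (v u : ℕ) : Set ℓ where
    constructor coords≈
    field ≈bᵛaᵘ : x ≈ pow b v ∙ pow a u

  coords : Carrier → ℕ × ℕ
  coords g = let (i , j , _) = proj₁ semidirect g in j , i * r ^ j

  coords-correct : ∀ g → Coords g (proj₁ (coords g)) (proj₂ (coords g))
  coords-correct g = let (i , j , g≈aⁱbʲ) = proj₁ semidirect g in coords≈ (trans g≈aⁱbʲ (aᵘ∙bʲ≈bʲ∙aᵘʳʲ i j))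

  ≈ε⇒Coords : ∀ {x} → x ≈ ε → Coords x 0 0
  ≈ε⇒Coords x≈ε = coords≈ (trans x≈ε (sym (identityˡ ε)))

  Coords-ε : Coords ε 0 0
  Coords-ε = ≈ε⇒Coords refl

  Coords-∙ : ∀ {x g v u j i} → Coords x v u → Coords g j i → Coords (x ∙ g) (v + j) (u * r ^ j + i)
  Coords-∙ {x} {g} {v} {u} {j} {i} (coords≈ x≈bᵛaᵘ) (coords≈ g≈bʲaⁱ) = coords≈ (begin
    x ∙ g                                                ≈⟨ ∙-cong x≈bᵛaᵘ g≈bʲaⁱ ⟩
    (pow b v ∙ pow a u) ∙ (pow b j ∙ pow a i)            ≈⟨ assoc _ _ _ ⟩
    pow b v ∙ (pow a u ∙ (pow b j ∙ pow a i))            ≈⟨ ∙-congˡ (assoc _ _ _) ⟨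
    pow b v ∙ ((pow a u ∙ pow b j) ∙ pow a i)            ≈⟨ ∙-congˡ (∙-congʳ (aᵘ∙bʲ≈bʲ∙aᵘʳʲ u j)) ⟩
    pow b v ∙ ((pow b j ∙ pow a (u * r ^ j)) ∙ pow a i)  ≈⟨ ∙-congˡ (assoc _ _ _) ⟩
    pow b v ∙ (pow b j ∙ (pow a (u * r ^ j) ∙ pow a i))  ≈⟨ assoc _ _ _ ⟨
    (pow b v ∙ pow b j) ∙ (pow a (u * r ^ j) ∙ pow a i)  ≈⟨ ∙-cong (pow-+ b v j) (pow-+ a (u * r ^ j) i) ⟨
    pow b (v + j) ∙ pow a (u * r ^ j + i)                ∎)

  Coords⇒≈ε : ∀ {x v u} → Coords x v u → v % m ≡ 0 → u % n ≡ 0 → x ≈ ε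
  Coords⇒≈ε {v = v} {u} (coords≈ x≈bᵛaᵘ) v%m≡0 u%n≡0 =
    trans x≈bᵛaᵘ (trans (∙-cong (B.%≡0⇒pow≈ε v v%m≡0) (A.%≡0⇒pow≈ε u u%n≡0)) (identityˡ ε))

  -- bᵛ⁻ᵛ′ = aᵘ′⁻ᵘ lies in ⟨a⟩ ∩ ⟨b⟩ = 1; the negative exponents are written with pred m and pred n.
  Coords-unique : ∀ {x v u v′ u′} → Coords x v u → Coords x v′ u′ → v % m ≡ v′ % m × u % n ≡ u′ % n
  Coords-unique {x} {v} {u} {v′} {u′} (coords≈ x≈bᵛaᵘ) (coords≈ x≈bᵛ′aᵘ′) =
    [x+pred[n]*y]%n≡0⇒x%n≡y%n v v′ m (B.pow≈ε⇒%≡0 V bⱽ≈ε) ,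
    ≡.sym ([x+pred[n]*y]%n≡0⇒x%n≡y%n u′ u n (A.pow≈ε⇒%≡0 U aᵁ≈ε))
    where
      V = v + pred m * v′
      U = u′ + pred n * u
      pred[m]*v′+v′≡v′*m : pred m * v′ + v′ ≡ v′ * m
      pred[m]*v′+v′≡v′*m = ≡.trans (+-comm (pred m * v′) v′) (x+pred[k]*x≡x*k v′ m)
      bⱽ∙aᵘ≈aᵘ′ : pow b V ∙ pow a u ≈ pow a u′
      bⱽ∙aᵘ≈aᵘ′ = begin
        pow b V ∙ pow a u                               ≡⟨ ≡.cong (λ k → pow b k ∙ pow a u) (+-comm v (pred m * v′)) ⟩
        pow b (pred m * v′ + v) ∙ pow a u               ≈⟨ ∙-congʳ (pow-+ b (pred m * v′) v) ⟩
        (pow b (pred m * v′) ∙ pow b v) ∙ pow a u       ≈⟨ assoc _ _ _ ⟩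
        pow b (pred m * v′) ∙ (pow b v ∙ pow a u)       ≈⟨ ∙-congˡ (trans (sym x≈bᵛaᵘ) x≈bᵛ′aᵘ′) ⟩
        pow b (pred m * v′) ∙ (pow b v′ ∙ pow a u′)     ≈⟨ assoc _ _ _ ⟨
        (pow b (pred m * v′) ∙ pow b v′) ∙ pow a u′     ≈⟨ ∙-congʳ (pow-+ b (pred m * v′) v′) ⟨
        pow b (pred m * v′ + v′) ∙ pow a u′             ≡⟨ ≡.cong (λ k → pow b k ∙ pow a u′) pred[m]*v′+v′≡v′*m ⟩
        pow b (v′ * m) ∙ pow a u′                       ≈⟨ ∙-congʳ (B.pow-multiple v′) ⟩
        ε ∙ pow a u′                                    ≈⟨ identityˡ _ ⟩
        pow a u′                                        ∎
      bⱽ≈aᵁ : pow b V ≈ pow a U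
      bⱽ≈aᵁ = begin
        pow b V                                         ≈⟨ identityʳ _ ⟨
        pow b V ∙ ε                                     ≈⟨ ∙-congˡ (A.pow-multiple u) ⟨
        pow b V ∙ pow a (u * n)                         ≡⟨ ≡.cong (λ k → pow b V ∙ pow a k) (x+pred[k]*x≡x*k u n) ⟨
        pow b V ∙ pow a (u + pred n * u)                ≈⟨ ∙-congˡ (pow-+ a u (pred n * u)) ⟩
        pow b V ∙ (pow a u ∙ pow a (pred n * u))        ≈⟨ assoc _ _ _ ⟨
        (pow b V ∙ pow a u) ∙ pow a (pred n * u)        ≈⟨ ∙-congʳ bⱽ∙aᵘ≈aᵘ′ ⟩
        pow a u′ ∙ pow a (pred n * u)                   ≈⟨ pow-+ a u′ (pred n * u) ⟨
        pow a U                                         ∎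
      aᵁ≈ε : pow a U ≈ ε
      aᵁ≈ε = proj₂ semidirect U V (sym bⱽ≈aᵁ)
      bⱽ≈ε : pow b V ≈ ε
      bⱽ≈ε = trans bⱽ≈aᵁ aᵁ≈ε

module UpperBound {c ℓ : Level} (G : Group c ℓ) (a b : Group.Carrier G) (p α β e : ℕ)
                  (p-prime : Prime p) (1≤e : 1 ≤ e)
                  (semidirect : GroupDefs.IsSemidirectCyclic G a b)
                  (commutator : Group._≈_ G (GroupDefs.comm G a b) (GroupDefs.pow G a (p ^ e)))
                  (a-order : GroupDefs.HasOrder G a (p ^ α)) (b-order : GroupDefs.HasOrder G b (p ^ β)) where

  open Group G
  open GroupDefs G
  open GridDifferences p p-prime
    using (p≢0; Grid; Periodic; p-1; [p-1]^k≉0; ≡⇒≈; *-congˡ; +-cong)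
    renaming (_≈_ to _≈ₚ_; ≈-trans to ≈ₚ-trans; ≈-sym to ≈ₚ-sym)
  open GridDifferences.Translations p p-prime e 1≤e using (∏[ρ-1]; ∏[ρ-1]-periodic≈0)
  open Metacyclic G a b (p ^ α) (p ^ β) (p ^ e) semidirect commutator a-order b-order

  indicator : ℕ → ℕ → ℕ
  indicator zero zero = 1
  indicator _    _    = 0

  δ : Grid
  δ v u = indicator (v % p ^ β) (u % p ^ α)

  δ-periodic : Periodic (p ^ β) (p ^ α) δ
  δ-periodic = (λ v u → ≡.cong (λ k → indicator k (u % p ^ α)) ([m+n]%n≡m%n v (p ^ β)))
             , (λ v u → ≡.cong (indicator (v % p ^ β)) ([m+n]%n≡m%n u (p ^ α)))

  δ≡0⊎≈ε : ∀ {x v u} → Coords x v u → δ v u ≡ 0 ⊎ x ≈ ε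
  δ≡0⊎≈ε {v = v} {u} x≈bᵛaᵘ with v % p ^ β in v%m≡ | u % p ^ α in u%n≡
  ... | zero  | zero  = inj₂ (Coords⇒≈ε x≈bᵛaᵘ v%m≡ u%n≡)
  ... | zero  | suc _ = inj₁ ≡.refl
  ... | suc _ | _     = inj₁ ≡.refl

  δ-ε : δ 0 0 ≡ 1
  δ-ε = ≡.cong₂ indicator (m<n⇒m%n≡m (>-nonZero⁻¹ (p ^ β))) (m<n⇒m%n≡m (>-nonZero⁻¹ (p ^ α)))

  CompletesToε : List Carrier → Carrier → Set (c ⊔ ℓ)
  CompletesToε gs x = ∃[ ys ] (ys ⊆ gs × ys ≢ [] × x ∙ prod ys ≈ ε)

  -- Expanding ∏ (ρ_g - 1) δ at x yields one term ± δ (x ∙ prod ys) per subsequence ys of gs;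
  -- unless some nonempty ys completes x to ε, only ys = [] survives.
  ∏[ρ-1]δ≈ : ∀ gs {x v u} → Coords x v u →
             CompletesToε gs x ⊎ ∏[ρ-1] (map coords gs) δ v u ≈ₚ p-1 ^ length gs * δ v u
  ∏[ρ-1]δ≈ []       x≈bᵛaᵘ = inj₂ (≡⇒≈ (≡.sym (*-identityˡ _)))
  ∏[ρ-1]δ≈ (g ∷ gs) {x} {v} {u} x≈bᵛaᵘ with ∏[ρ-1]δ≈ gs (Coords-∙ x≈bᵛaᵘ (coords-correct g))
  ... | inj₁ (ys , ys⊆gs , ys≢[] , x∙g∙ys≈ε) =
    inj₁ (g ∷ ys , ≡.refl ∷ ys⊆gs , (λ ()) , trans (sym (assoc x g (prod ys))) x∙g∙ys≈ε)
  ... | inj₂ at-x∙g with δ≡0⊎≈ε (Coords-∙ x≈bᵛaᵘ (coords-correct g))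
  ...   | inj₂ x∙g≈ε = inj₁ (g ∷ [] , ≡.refl ∷ minimum gs , (λ ()) , trans (∙-congˡ (identityʳ g)) x∙g≈ε)
  ...   | inj₁ δ[x∙g]≡0 with ∏[ρ-1]δ≈ gs x≈bᵛaᵘ
  ...     | inj₁ (ys , ys⊆gs , ys≢[] , x∙ys≈ε) = inj₁ (ys , g ∷ʳ ys⊆gs , ys≢[] , x∙ys≈ε)
  ...     | inj₂ at-x = inj₂ (≈ₚ-trans (+-cong at-x∙g (*-congˡ p-1 at-x)) (≡⇒≈ (begin
    p-1 ^ K * δ _ _ + p-1 * (p-1 ^ K * δ v u)   ≡⟨ ≡.cong (λ z → p-1 ^ K * z + p-1 * (p-1 ^ K * δ v u)) δ[x∙g]≡0 ⟩
    p-1 ^ K * 0 + p-1 * (p-1 ^ K * δ v u)       ≡⟨ regroup (p-1 ^ K) p-1 (δ v u) ⟩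
    p-1 ^ suc K * δ v u                          ∎)))
    where
      open ≡.≡-Reasoning
      K = length gs
      regroup : ∀ y w d → y * 0 + w * (y * d) ≡ w * y * d
      regroup = solve-∀

  upper-bound : DProp (pred (p ^ α) + p ^ β)
  upper-bound xs |xs|≡ with ∏[ρ-1]δ≈ xs Coords-ε
  ... | inj₁ (ys , ys⊆xs , ys≢[] , ε∙ys≈ε) = ys , ys⊆xs , ys≢[] , trans (sym (identityˡ _)) ε∙ys≈ε
  ... | inj₂ at-ε = ⊥-elim ([p-1]^k≉0 (length xs) (≈ₚ-trans (≈ₚ-sym [p-1]^|xs|≈) vanishes))
    where
      [p-1]^|xs|≈ : ∏[ρ-1] (map coords xs) δ 0 0 ≈ₚ p-1 ^ length xs
      [p-1]^|xs|≈ = ≈ₚ-trans at-ε (≡⇒≈ (≡.trans (≡.cong (p-1 ^ length xs *_) δ-ε) (*-identityʳ _)))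
      vanishes : ∏[ρ-1] (map coords xs) δ 0 0 ≈ₚ 0
      vanishes = ∏[ρ-1]-periodic≈0 α β (map coords xs) δ δ-periodic (≡.trans (length-map coords xs) |xs|≡)

module LowerBound {c ℓ : Level} (G : Group c ℓ) (a b : Group.Carrier G) (n m q : ℕ)
                  (semidirect : GroupDefs.IsSemidirectCyclic G a b)
                  (commutator : Group._≈_ G (GroupDefs.comm G a b) (GroupDefs.pow G a q))
                  (a-order : GroupDefs.HasOrder G a n) (b-order : GroupDefs.HasOrder G b m) where

  open Group G
  open GroupDefs G
  open Metacyclic G a b n m q semidirect commutator a-order b-order
  open Modulo m
    using (mk≈; %-≡; ≡⇒≈; +-cong; *-congˡ) renaming (_≈_ to _≈ₘ_; ≈-sym to ≈ₘ-sym; ≈-trans to ≈ₘ-trans)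

  v-coord : Carrier → ℕ
  v-coord = proj₁ ∘ coords

  prod-Coords : ∀ ws → ∃[ u ] Coords (prod ws) (sum (map v-coord ws)) u
  prod-Coords []       = 0 , Coords-ε
  prod-Coords (g ∷ ws) = let (u , prod≈) = prod-Coords ws in _ , Coords-∙ (coords-correct g) prod≈

  v-coord-a : v-coord a ≈ₘ 0
  v-coord-a = mk≈ (proj₁ (Coords-unique (coords-correct a) a-Coords))
    where
      a-Coords : Coords a 0 1
      a-Coords = coords≈ (sym (trans (identityˡ _) (identityʳ a)))

  v-coord-b : v-coord b ≈ₘ 1
  v-coord-b = mk≈ (proj₁ (Coords-unique (coords-correct b) b-Coords))
    where
      b-Coords : Coords b 1 0
      b-Coords = coords≈ (sym (trans (identityʳ _) (identityʳ b)))

  -- The b-exponent modulo m is additive along products, so it counts the b's of zs.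
  b-count≡0 : ∀ s t zs → t < m → zs ↭ replicate s a ++ replicate t b → prod zs ≈ ε → t ≡ 0
  b-count≡0 s t zs t<m zs↭ prod≈ε =
    ≡.trans (≡.sym (m<n⇒m%n≡m t<m)) (≡.trans (%-≡ t≈0) (m<n⇒m%n≡m (>-nonZero⁻¹ m)))
    where
      Σv≡ : sum (map v-coord zs) ≡ s * v-coord a + t * v-coord b
      Σv≡ = begin
        sum (map v-coord zs)                                            ≡⟨ sum-↭ (map⁺ v-coord zs↭) ⟩
        sum (map v-coord (replicate s a ++ replicate t b))              ≡⟨ ≡.cong sum (map-++ v-coord (replicate s a) _) ⟩
        sum (map v-coord (replicate s a) ++ map v-coord (replicate t b)) ≡⟨ sum-++ (map v-coord (replicate s a)) _ ⟩
        sum (map v-coord (replicate s a)) + sum (map v-coord (replicate t b))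
          ≡⟨ ≡.cong₂ (λ xs ys → sum xs + sum ys) (map-replicate v-coord s a) (map-replicate v-coord t b) ⟩
        sum (replicate s (v-coord a)) + sum (replicate t (v-coord b))   ≡⟨ ≡.cong₂ _+_ (sum-replicate s _) (sum-replicate t _) ⟩
        s * v-coord a + t * v-coord b                                   ∎
        where open ≡.≡-Reasoning
      Σv≈t : sum (map v-coord zs) ≈ₘ t
      Σv≈t = ≈ₘ-trans (≡⇒≈ Σv≡) (≈ₘ-trans (+-cong (*-congˡ s v-coord-a) (*-congˡ t v-coord-b))
                                          (≡⇒≈ (≡.cong₂ _+_ (*-zeroʳ s) (*-identityʳ t))))
      Σv≈0 : sum (map v-coord zs) ≈ₘ 0
      Σv≈0 = let (_ , prod≈) = prod-Coords zs in mk≈ (proj₁ (Coords-unique prod≈ (≈ε⇒Coords prod≈ε)))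
      t≈0 : t ≈ₘ 0
      t≈0 = ≈ₘ-trans (≈ₘ-sym Σv≈t) Σv≈0

  prod-↭-replicate : ∀ s zs → zs ↭ replicate s a → prod zs ≡ pow a s
  prod-↭-replicate s zs zs↭ = ≡.trans (prod-all zs (All-resp-↭ (↭-sym zs↭) (replicate⁺ s ≡.refl)))
                                     (≡.cong (pow a) (≡.trans (↭-length zs↭) (length-replicate s)))
    where
      prod-all : ∀ zs → All (_≡ a) zs → prod zs ≡ pow a (length zs)
      prod-all []       []             = ≡.refl
      prod-all (z ∷ zs) (≡.refl ∷ all) = ≡.cong (a ∙_) (prod-all zs all)

  lower-bound : ¬ D′Prop (pred n + pred m)
  lower-bound D′ with D′ (replicate (pred n) a ++ replicate (pred m) b)
                         (≡.trans (length-++ (replicate (pred n) a)) (≡.cong₂ _+_ (length-replicate (pred n)) (length-replicate (pred m))))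
  ... | ys , ys⊆xs , ys≢[] , zs , zs↭ys , prod≈ε with ⊆-replicate-++ (pred n) ys⊆xs
  ... | s , ys′ , s≤pred[n] , ≡.refl , ys′⊆ with ⊆-replicate (pred m) ys′⊆
  ... | t , t≤pred[m] , ≡.refl with b-count≡0 s t zs (m≤pred[n]⇒suc[m]≤n t≤pred[m]) zs↭ys prod≈ε
  ... | ≡.refl with s
  ...   | zero  = ys≢[] ≡.refl
  ...   | suc s′ = proj₂ (proj₂ a-order) (suc s′) (s≤s z≤n) (m≤pred[n]⇒suc[m]≤n s≤pred[n])
                     (trans (reflexive (≡.sym (prod-↭-replicate (suc s′) zs (≡.subst (zs ↭_) (++-identityʳ _) zs↭ys)))) prod≈ε)

module _ {c ℓ : Level} (G : Group c ℓ) where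

  open GroupDefs G

  DProp⇒D′Prop : ∀ {k} → DProp k → D′Prop k
  DProp⇒D′Prop D xs |xs|≡ =
    let (ys , ys⊆xs , ys≢[] , prod≈ε) = D xs |xs|≡ in ys , ys⊆xs , ys≢[] , ys , ↭-refl , prod≈ε

  D′Prop-mono : ∀ {j k} → j ≤ k → D′Prop j → D′Prop k
  D′Prop-mono {j} j≤k D′ xs |xs|≡k =
    let |take|≡j = ≡.trans (length-take j xs) (m≤n⇒m⊓n≡m (≡.subst (j ≤_) (≡.sym |xs|≡k) j≤k))
        (ys , ys⊆ , ys≢[] , rest) = D′ (take j xs) |take|≡j
    in ys , ⊆-trans ys⊆ (take-⊆ j xs) , ys≢[] , rest

corollary4p1 : ∀ {c ℓ : Level} (G : Group c ℓ) (p α β γ : ℕ) (a b : Group.Carrier G) →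
    Prime p → p ≢ 2 →
    2 * γ ≤ α → γ ≤ β → 1 ≤ γ →
    GroupDefs.IsSemidirectCyclic G a b →
    Group._≈_ G (GroupDefs.comm G a b) (GroupDefs.pow G a (p ^ (α ∸ γ))) →
    GroupDefs.HasOrder G a (p ^ α) →
    GroupDefs.HasOrder G b (p ^ β) →
    GroupDefs.HasOrder G (GroupDefs.comm G a b) (p ^ γ) →
    ∃[ k ] (GroupDefs.IsD G k × GroupDefs.IsD′ G k)
corollary4p1 G p α β γ a b p-prime _ 2γ≤α _ 1≤γ semidirect commutator a-order b-order _ =
  K , (0<K , upper , λ j 0<j j<K → below j 0<j j<K ∘ DProp⇒D′Prop G) , (0<K , DProp⇒D′Prop G upper , below)
  where
    open GroupDefs G
    K = pred (p ^ α) + p ^ β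
    1≤α∸γ : 1 ≤ α ∸ γ
    1≤α∸γ = m<n⇒0<n∸m (<-≤-trans (m<m+n γ (≤-trans 1≤γ (m≤m+n γ 0))) 2γ≤α)
    upper : DProp K
    upper = UpperBound.upper-bound G a b p α β (α ∸ γ) p-prime 1≤α∸γ semidirect commutator a-order b-order
    0<K : 0 < K
    0<K = ≤-trans (proj₁ b-order) (m≤n+m (p ^ β) _)
    below : ∀ j → 0 < j → j < K → ¬ D′Prop j
    below j _ j<K D′ = LowerBound.lower-bound G a b (p ^ α) (p ^ β) (p ^ (α ∸ γ)) semidirect commutator a-order b-order
                         (D′Prop-mono G (≤-pred (≤-trans j<K (≤-reflexive K≡))) D′)
      where
        K≡ : K ≡ suc (pred (p ^ α) + pred (p ^ β))
        K≡ = ≡.trans (≡.cong (pred (p ^ α) +_) (≡.sym (suc-pred (p ^ β) {{>-nonZero (proj₁ b-order)}}))) (+-suc _ _)
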